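{- Let $Z$ be an $n$-dimensional Gorenstein fake weighted projective space with $\mathrm{Cl}(Z)\cong\mathbb{Z}\oplus\mathbb{Z}/\mu_1\mathbb{Z}\oplus\dots\oplus\mathbb{Z}/\mu_r\mathbb{Z}$ in invariant factor form. Then $Z\cong Z(Q)$ for a degree matrix $$Q=\begin{bmatrix} w_0&\dots&w_n\\ \eta_{01}&\dots&\eta_{n1}\\ \vdots&&\vdots\\ \eta_{0r}&\dots&\eta_{nr}\end{bmatrix}$$ in $\mathbb{Z}\oplus\mathbb{Z}/\mu_1\mathbb{Z}\oplus\dots\oplus\mathbb{Z}/\mu_r\mathbb{Z}$ such that $w=[w_0,\dots,w_n]$ is a Gorenstein weight vector, for each $i=1,\dots,r$ the row $\eta_{\ast i}=[\eta_{0i},\dots,\eta_{ni}]$ is a minimal Gorenstein torsion vector of order $\mu_i$ for $w$, and $\eta_{\ast i}<\eta_{\ast j}$ whenever $i<j$ and $\mu_i=\mu_j$.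
   Context: Invariant factor form: $G=\mathbb{Z}\oplus\mathbb{Z}/\mu_1\mathbb{Z}\oplus\dots\oplus\mathbb{Z}/\mu_r\mathbb{Z}$ with integers $\mu_i\ge2$, $\mu_r\mid\mu_{r-1}\mid\dots\mid\mu_1$. A degree matrix in $G$ (of size $n+1$) is a matrix $Q=[\omega_0,\dots,\omega_n]$ with columns $\omega_i=(w_i,\eta_i)\in G$, $w_i\in\mathbb{Z}_{\ge1}$, such that any $n$ of the $\omega_i$ generate $G$. A fake weighted projective space (fwps) $Z(P)$ is the toric variety whose fan has as maximal cones the cones over the facets of $\mathrm{conv}(v_0,\dots,v_n)$, for $P=[v_0,\dots,v_n]$ an integer $n\times(n+1)$ matrix with pairwise distinct primitive columns generating $\mathbb{R}^n$ as a convex cone; its class group is $\mathbb{Z}^{n+1}/\mathrm{im}(P^T)$, with $e_i$ giving the class of the invariant prime divisor $D_i$. For a degree matrix $Q$, $Z(Q)$ denotes the fwps $Z(P)$ where the rows of $P$ form a $\mathbb{Z}$-basis of the kernel of $\mathbb{Z}^{n+1}\to G$, $e_i\mapsto\omega_i$; then $\mathrm{Cl}(Z(Q))\cong G$ with $[D_i]\mapsto\omega_i$. A fwps is Gorenstein if its anticanonical divisor $\sum_i D_i$ is Cartier. A vector $w\in\mathbb{Z}_{\ge1}^{n+1}$ is a (Gorenstein) weight vector if it is a degree matrix in $\mathbb{Z}$ (i.e. $r=0$) and $Z(w)$ is (Gorenstein). For a weight vector $w$ and $\mu\ge2$, a vector $\eta\in(\mathbb{Z}/\mu\mathbb{Z})^{n+1}$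 is a (Gorenstein) torsion vector of order $\mu$ for $w$ if the matrix with rows $w$ and $\eta$ is a degree matrix in $\mathbb{Z}\oplus\mathbb{Z}/\mu\mathbb{Z}$ (whose fwps is Gorenstein). Two torsion vectors $\eta,\zeta$ of order $\mu$ for $w$ are equivalent if some automorphism of $\mathbb{Z}\oplus\mathbb{Z}/\mu\mathbb{Z}$ sends $(w_i,\eta_i)$ to $(w_i,\zeta_i)$ for all $i$. We write $\eta\le\zeta$ (resp. $\eta<\zeta$) if $[\eta'_0,\dots,\eta'_n]$ is lexicographically $\le$ (resp. $<$) $[\zeta'_0,\dots,\zeta'_n]$, where $\eta'_i,\zeta'_i\in\{0,\dots,\mu-1\}$ are the representatives. A torsion vector $\eta$ is minimal if $\eta\le\zeta$ for all $\zeta$ equivalent to $\eta$. -}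

module Defs where

open import Data.Nat as ℕ using (ℕ; zero; suc)
import Data.Nat.Divisibility as ℕD
open import Data.Integer as ℤ using (ℤ; +_; _+_; _*_; -_; _-_)
open import Data.Integer.Divisibility using (_∣_)
open import Data.Integer.DivMod using (_%ℕ_)
open import Data.Fin as Fin using (Fin; zero; suc)
open import Data.Fin.Permutation using (Permutation′; _⟨$⟩ʳ_)
open import Data.Product using (Σ; ∃; ∃-syntax; _×_; _,_; proj₁; proj₂)
open import Data.Sum using (_⊎_)
open import Relation.Binary.PropositionalEquality using (_≡_)
open import Relation.Nullary using (¬_)

sumᶠ : ∀ {m} → (Fin m → ℤ) → ℤ
sumᶠ {zero}  f = + 0
sumᶠ {suc m} f = f zero + sumᶠ (λ i → f (suc i))

-- integer matrices with a rows and b columns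
Mat : ℕ → ℕ → Set
Mat a b = Fin a → Fin b → ℤ

col : ∀ {a b} → Mat a b → Fin b → Fin a → ℤ
col P i k = P k i

dot : ∀ {m} → (Fin m → ℤ) → (Fin m → ℤ) → ℤ
dot u v = sumᶠ (λ k → u k * v k)

matVec : ∀ {a b} → Mat a b → (Fin b → ℤ) → Fin a → ℤ
matVec A v k = dot (A k) v

Unimodular : ∀ {n} → Mat n n → Set
Unimodular {n} A = ∃[ B ] ((∀ (v : Fin n → ℤ) k → matVec A (matVec B v) k ≡ v k)
                         × (∀ (v : Fin n → ℤ) k → matVec B (matVec A v) k ≡ v k))

Primitive : ∀ {n} → (Fin n → ℤ) → Set
Primitive v = ∀ (d : ℕ) → (∀ k → + d ∣ v k) → d ≡ 1

-- the columns generate ℝ^n as a convex cone (equivalently, for integral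
-- generators: every integral vector is a non-negative rational combination)
GeneratesAsCone : ∀ {n m} → Mat n m → Set
GeneratesAsCone {n} {m} P =
  ∀ (u : Fin n → ℤ) → Σ (Fin m → ℕ) λ c → Σ ℕ λ t →
    (1 ℕ.≤ t × (∀ k → sumᶠ (λ (i : Fin m) → + (c i) * P k i) ≡ + t * u k))

IsFWPS : ∀ {n} → Mat n (suc n) → Set
IsFWPS P = (∀ i → Primitive (col P i))
         × (∀ i j → (∀ k → P k i ≡ P k j) → i ≡ j)
         × GeneratesAsCone P

-- Z(P) is Gorenstein: the anticanonical divisor Σ D_i is Cartier, i.e. on each
-- maximal cone σ_i = cone(v_j : j ≠ i) there is a linear form m_i with
-- ⟨m_i , v_j⟩ = -1 for all rays v_j of σ_i.
Gorenstein : ∀ {n} → Mat n (suc n) → Set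
Gorenstein {n} P = ∀ (i : Fin (suc n)) → ∃[ u ]
  (∀ j → ¬ (j ≡ i) → dot u (col P j) ≡ - (+ 1))

-- Z(P) ≅ Z(P') : a lattice automorphism mapping the fan of Z(P) onto that of Z(P'),
-- i.e. mapping the ray generators v_i bijectively onto the v'_j.
FWPSIso : ∀ {n} → Mat n (suc n) → Mat n (suc n) → Set
FWPSIso {n} P P' = Σ (Mat n n) λ A → Unimodular A × Σ (Permutation′ (suc n)) λ σ →
  (∀ (i : Fin (suc n)) k → matVec A (col P i) k ≡ P' k (σ ⟨$⟩ʳ i))

-- The group G = ℤ ⊕ ℤ/μ_1 ⊕ … ⊕ ℤ/μ_r, elements given by integer representatives

G : ℕ → Set
G r = ℤ × (Fin r → ℤ)

Eq : ∀ {r} → (Fin r → ℕ) → G r → G r → Set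
Eq μ g h = (proj₁ g ≡ proj₁ h) × (∀ k → + (μ k) ∣ (proj₂ g k - proj₂ h k))

0G : ∀ {r} → G r
0G = (+ 0 , λ _ → + 0)

_+G_ : ∀ {r} → G r → G r → G r
g +G h = (proj₁ g + proj₁ h , λ k → proj₂ g k + proj₂ h k)

combG : ∀ {m r} → (Fin m → ℤ) → (Fin m → G r) → G r
combG x Q = ( sumᶠ (λ i → x i * proj₁ (Q i))
            , λ k → sumᶠ (λ i → x i * proj₂ (Q i) k))

InvariantFactorForm : ∀ {r} → (Fin r → ℕ) → Set
InvariantFactorForm μ = (∀ k → 2 ℕ.≤ μ k) × (∀ k l → k Fin.≤ l → μ l ℕD.∣ μ k)

record Aut {r : ℕ} (μ : Fin r → ℕ) : Set where
  field
    to      : G r → G r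
    from    : G r → G r
    to-cong   : ∀ g h → Eq μ g h → Eq μ (to g) (to h)
    from-cong : ∀ g h → Eq μ g h → Eq μ (from g) (from h)
    to-hom  : ∀ g h → Eq μ (to (g +G h)) (to g +G to h)
    to-from : ∀ g → Eq μ (to (from g)) g
    from-to : ∀ g → Eq μ (from (to g)) g

DegreeMatrix : ∀ {n r} → (Fin r → ℕ) → (Fin (suc n) → G r) → Set
DegreeMatrix {n} μ Q =
    (∀ i → + 1 ℤ.≤ proj₁ (Q i))
  × (∀ (i : Fin (suc n)) (g : G _) → ∃[ x ] ((x i ≡ + 0) × Eq μ (combG x Q) g))

KernelBasis : ∀ {n r} → (Fin r → ℕ) → (Fin (suc n) → G r) → Mat n (suc n) → Set
KernelBasis {n} μ Q P' =
    (∀ k → Eq μ (combG (P' k) Q) 0G)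
  × (∀ (x : Fin (suc n) → ℤ) → Eq μ (combG x Q) 0G →
       Σ (Fin n → ℤ) λ c → (∀ i → x i ≡ sumᶠ (λ k → c k * P' k i)))
  × (∀ (c : Fin n → ℤ) → (∀ i → sumᶠ (λ k → c k * P' k i) ≡ + 0) → ∀ k → c k ≡ + 0)

-- Z(Q) (for some, equivalently any, choice of kernel basis) is Gorenstein
GorensteinDeg : ∀ {n r} → (Fin r → ℕ) → (Fin (suc n) → G r) → Set
GorensteinDeg μ Q = ∃[ P' ] (KernelBasis μ Q P' × Gorenstein P')

-- Cl(Z(P)) = ℤ^{n+1}/im(P^T) ≅ G : a surjection ℤ^{n+1} → G (e_i ↦ Q i) with kernel im(P^T)
ClassGroupIso : ∀ {n r} → Mat n (suc n) → (Fin r → ℕ) → Set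
ClassGroupIso {n} {r} P μ = ∃[ Q ]
    ((∀ (g : G r) → ∃[ x ] Eq μ (combG x Q) g)
  × (∀ (x : Fin (suc n) → ℤ) → Eq μ (combG x Q) 0G →
       Σ (Fin n → ℤ) λ c → (∀ i → x i ≡ sumᶠ (λ k → c k * P k i)))
  × (∀ (c : Fin n → ℤ) → Eq μ (combG (λ i → sumᶠ (λ k → c k * P k i)) Q) 0G))

noTorsion : Fin 0 → ℕ
noTorsion ()

asG0 : ∀ {n} → (Fin (suc n) → ℤ) → Fin (suc n) → G 0
asG0 w i = (w i , λ ())

oneTorsion : ℕ → Fin 1 → ℕ
oneTorsion μ _ = μ

asG1 : ∀ {n} → (Fin (suc n) → ℤ) → (Fin (suc n) → ℤ) → Fin (suc n) → G 1
asG1 w η i = (w i , λ _ → η i)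

WeightVector : ∀ {n} → (Fin (suc n) → ℤ) → Set
WeightVector w = DegreeMatrix noTorsion (asG0 w)

GorensteinWeightVector : ∀ {n} → (Fin (suc n) → ℤ) → Set
GorensteinWeightVector w = WeightVector w × GorensteinDeg noTorsion (asG0 w)

TorsionVector : ∀ {n} → (Fin (suc n) → ℤ) → ℕ → (Fin (suc n) → ℤ) → Set
TorsionVector w μ η = DegreeMatrix (oneTorsion μ) (asG1 w η)

GorensteinTorsionVector : ∀ {n} → (Fin (suc n) → ℤ) → ℕ → (Fin (suc n) → ℤ) → Set
GorensteinTorsionVector w μ η =
  TorsionVector w μ η × GorensteinDeg (oneTorsion μ) (asG1 w η)

EquivTorsion : ∀ {n} → (Fin (suc n) → ℤ) → ℕ → (Fin (suc n) → ℤ) → (Fin (suc n) → ℤ) → Set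
EquivTorsion w μ η ζ = ∃[ φ ]
  (∀ i → Eq (oneTorsion μ) (Aut.to {μ = oneTorsion μ} φ (w i , λ _ → η i)) (w i , λ _ → ζ i))

rep : ℕ → ℤ → ℕ
rep zero    x = 0
rep (suc m) x = x %ℕ suc m

reps : ∀ {n} → ℕ → (Fin n → ℤ) → Fin n → ℕ
reps μ η i = rep μ (η i)

LexLt : ∀ {n} → (Fin n → ℕ) → (Fin n → ℕ) → Set
LexLt a b = ∃[ i ] ((a i ℕ.< b i) × (∀ j → j Fin.< i → a j ≡ b j))

LexLe : ∀ {n} → (Fin n → ℕ) → (Fin n → ℕ) → Set
LexLe a b = LexLt a b ⊎ (∀ i → a i ≡ b i)

MinimalTorsion : ∀ {n} → (Fin (suc n) → ℤ) → ℕ → (Fin (suc n) → ℤ) → Set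
MinimalTorsion w μ η = ∀ ζ → EquivTorsion w μ η ζ → LexLe (reps μ η) (reps μ ζ)

MinimalGorensteinTorsionVector : ∀ {n} → (Fin (suc n) → ℤ) → ℕ → (Fin (suc n) → ℤ) → Set
MinimalGorensteinTorsionVector w μ η = GorensteinTorsionVector w μ η × MinimalTorsion w μ η

weightRow : ∀ {n r} → (Fin (suc n) → G r) → Fin (suc n) → ℤ
weightRow Q i = proj₁ (Q i)

torsionRow : ∀ {n r} → (Fin (suc n) → G r) → Fin r → Fin (suc n) → ℤ
torsionRow Q k i = proj₂ (Q i) k

-- Automorphisms of G act on the class group presentation Q₀ : ℤ^{n+1} → G of Z(P) while preserving
-- generation by any n degrees, P as a basis of the relations and the Gorenstein condition, so Q₀
-- can be normalised step by step.
--   * The columns of P positively span ℝⁿ, so some relation Σ λᵢ vᵢ = 0 has all λᵢ ≥ 1. Up to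
--     torsion every relation is a multiple of the weights, so λ = m w: all weights have the sign of
--     m, and a sign change of ℤ makes them positive.
--   * An automorphism of ℤ ⊕ ℤ/μ fixing the weights acts on a torsion row as η ↦ a η + c w with a a
--     unit mod μ, so the lexicographically least row among the finitely many residues (a, c) is
--     minimal; a shear of G realises this choice in every row at once.
--   * Rows of equal order are distinct because the degrees generate G, so selection sort by
--     permutations of equal invariant factors makes them strictly increasing.
-- The degree matrix and Gorenstein properties then descend from G to ℤ and to each ℤ ⊕ ℤ/μₖ, whose
-- kernels have bases obtained by integral row reduction.
{-# OPTIONS --safe #-}
module Submission where

open import Defs
open import Data.Nat using (ℕ; suc; _≤_)
open import Data.Fin using (Fin; _<_)
open import Data.Product using (∃-syntax; _×_)
open import Relation.Binary.PropositionalEquality using (_≡_)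

open import Data.Empty using (⊥-elim)
open import Data.Fin as Fin using (zero; suc)
import Data.Fin.Properties as FinP
open import Data.Fin.Permutation using (Permutation′; _⟨$⟩ʳ_; _⟨$⟩ˡ_; inverseˡ; inverseʳ; transpose; _∘ₚ_)
import Data.Fin.Permutation as Perm
open import Data.Integer as ℤ using (ℤ; +_; _+_; _*_; -_; _-_)
import Data.Integer.Divisibility.Signed as S
open import Data.Integer.DivMod using (_%ℕ_; _/ℕ_)
import Data.Integer.DivMod as ℤDM
import Data.Integer.GCD as ℤGCD
import Data.Integer.Properties as ℤP
open import Data.Integer.Tactic.RingSolver using (solve-∀)
open import Data.List using (tabulate)
open import Data.List.Membership.Propositional.Properties using (∈-tabulate⁺)
open import Data.List.Relation.Unary.All.Properties using (tabulate⁺)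
open import Data.Nat as ℕ using (zero)
import Data.Nat.Divisibility as ℕD
open import Data.Nat.GCD using (gcd-GCD)
import Data.Nat.GCD as ℕGCD
open import Data.Nat.Induction using (<-rec)
open import Data.Nat.ListAction using (product)
open import Data.Nat.ListAction.Properties using (∈⇒∣product; product≢0)
import Data.Nat.Properties as ℕP
open import Data.Product using (Σ; ∃; _,_; proj₁; proj₂)
open import Data.Sum using (_⊎_; inj₁; inj₂)
open import Data.Unit using (⊤; tt)
open import Data.Vec.Functional using (Vector; tail; _∷_)
open import Function using (_∘_)
open import Relation.Binary.Bundles using (Setoid)
open import Relation.Binary.Definitions using (tri<; tri≈; tri>)
open import Relation.Binary.PropositionalEquality
  using (refl; sym; trans; cong; cong₂; subst; subst₂; module ≡-Reasoning)
import Relation.Binary.Reasoning.Setoid as SetoidReasoning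
open import Relation.Nullary using (¬_; Dec; yes; no)
import Relation.Nullary.Decidable as Dec
open import Relation.Unary using (Decidable)

open import Algebra.Properties.AbelianGroup ℤP.+-0-abelianGroup using (∙-cancelˡ)

-- Finite sums and unit vectors

Vz : ℕ → Set
Vz = Vector ℤ

ones : ∀ {m} → Vz m
ones _ = + 1

e : ∀ {m} → Fin m → Vz m
e zero    zero    = + 1
e zero    (suc j) = + 0
e (suc i) zero    = + 0
e (suc i) (suc j) = e i j

e-diag : ∀ {m} (i : Fin m) → e i i ≡ + 1
e-diag zero    = refl
e-diag (suc i) = e-diag i

e-offdiag : ∀ {m} (i j : Fin m) → ¬ i ≡ j → e i j ≡ + 0
e-offdiag zero    zero    i≢j = ⊥-elim (i≢j refl)
e-offdiag zero    (suc j) i≢j = refl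
e-offdiag (suc i) zero    i≢j = refl
e-offdiag (suc i) (suc j) i≢j = e-offdiag i j (λ i≡j → i≢j (cong suc i≡j))

e-sym : ∀ {m} (i j : Fin m) → e i j ≡ e j i
e-sym zero    zero    = refl
e-sym zero    (suc j) = refl
e-sym (suc i) zero    = refl
e-sym (suc i) (suc j) = e-sym i j

sum-cong : ∀ {m} {f g : Vz m} → (∀ i → f i ≡ g i) → sumᶠ f ≡ sumᶠ g
sum-cong {zero}  f≗g = refl
sum-cong {suc m} f≗g = cong₂ _+_ (f≗g zero) (sum-cong (λ i → f≗g (suc i)))

sum-zero : ∀ {m} (f : Vz m) → (∀ i → f i ≡ + 0) → sumᶠ f ≡ + 0
sum-zero {zero}  f f≗0 = refl
sum-zero {suc m} f f≗0 = cong₂ _+_ (f≗0 zero) (sum-zero (tail f) (λ i → f≗0 (suc i)))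

sum-+ : ∀ {m} (f g : Vz m) → sumᶠ (λ i → f i + g i) ≡ sumᶠ f + sumᶠ g
sum-+ {zero}  f g = refl
sum-+ {suc m} f g = trans (cong (_+_ (f zero + g zero)) (sum-+ (tail f) (tail g)))
                          (interchange (f zero) (g zero) (sumᶠ (tail f)) (sumᶠ (tail g)))
  where
  interchange : ∀ a b c d → a + b + (c + d) ≡ a + c + (b + d)
  interchange = solve-∀

sum-*ˡ : ∀ {m} (c : ℤ) (f : Vz m) → sumᶠ (λ i → c * f i) ≡ c * sumᶠ f
sum-*ˡ {zero}  c f = sym (ℤP.*-zeroʳ c)
sum-*ˡ {suc m} c f = trans (cong (_+_ (c * f zero)) (sum-*ˡ c (tail f)))
                           (sym (ℤP.*-distribˡ-+ c (f zero) _))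

sum-neg : ∀ {m} (f : Vz m) → sumᶠ (λ i → - f i) ≡ - sumᶠ f
sum-neg {zero}  f = refl
sum-neg {suc m} f = trans (cong (_+_ (- f zero)) (sum-neg (tail f)))
                          (sym (ℤP.neg-distrib-+ (f zero) (sumᶠ (tail f))))

sum-sub : ∀ {m} (f g : Vz m) → sumᶠ (λ i → f i - g i) ≡ sumᶠ f - sumᶠ g
sum-sub f g = trans (sum-+ f (λ i → - g i)) (cong (_+_ (sumᶠ f)) (sum-neg g))

sum-swap : ∀ {m p} (f : Fin m → Fin p → ℤ) →
           sumᶠ (λ i → sumᶠ (λ j → f i j)) ≡ sumᶠ (λ j → sumᶠ (λ i → f i j))
sum-swap {zero}  {p} f = sym (sum-zero {p} _ (λ _ → refl))
sum-swap {suc m} {p} f = trans (cong (_+_ (sumᶠ (f zero))) (sum-swap (λ i → f (suc i))))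
                               (sym (sum-+ (f zero) (λ j → sumᶠ (λ i → f (suc i) j))))

sum-supported : ∀ {m} (i : Fin m) (f : Vz m) → (∀ j → ¬ j ≡ i → f j ≡ + 0) → sumᶠ f ≡ f i
sum-supported {suc m} zero    f f≗0 =
  trans (cong (_+_ (f zero)) (sum-zero (tail f) (λ j → f≗0 (suc j) (λ ())))) (ℤP.+-identityʳ _)
sum-supported {suc m} (suc i) f f≗0 =
  trans (cong (_+ sumᶠ (tail f)) (f≗0 zero (λ ())))
        (trans (ℤP.+-identityˡ _)
               (sum-supported i (tail f) (λ j j≢i → f≗0 (suc j) (λ sj≡si → j≢i (FinP.suc-injective sj≡si)))))

sum-e : ∀ {m} (i : Fin m) (f : Vz m) → sumᶠ (λ j → e i j * f j) ≡ f i
sum-e i f = trans (sum-supported i _ (λ j j≢i → cong (_* f j) (e-offdiag i j (λ i≡j → j≢i (sym i≡j)))))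
                  (trans (cong (_* f i) (e-diag i)) (ℤP.*-identityˡ (f i)))

sum-eʳ : ∀ {m} (i : Fin m) (f : Vz m) → sumᶠ (λ j → f j * e j i) ≡ f i
sum-eʳ i f = trans (sum-cong (λ j → trans (ℤP.*-comm (f j) _) (cong (_* f j) (e-sym j i)))) (sum-e i f)

dot-comm : ∀ {m} (u v : Vz m) → dot u v ≡ dot v u
dot-comm u v = sum-cong (λ i → ℤP.*-comm (u i) (v i))

dot-congʳ : ∀ {m} (a : Vz m) {x y : Vz m} → (∀ i → x i ≡ y i) → dot a x ≡ dot a y
dot-congʳ a x≗y = sum-cong (λ i → cong (a i *_) (x≗y i))

dot-combination : ∀ {m q} (a : Vz m) (z : Vz q) (F : Fin q → Vz m) →
                  dot a (λ i → sumᶠ (λ k → z k * F k i)) ≡ sumᶠ (λ k → z k * dot a (F k))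
dot-combination a z F = begin
  sumᶠ (λ i → a i * sumᶠ (λ k → z k * F k i))
    ≡⟨ sum-cong (λ i → sym (sum-*ˡ (a i) (λ k → z k * F k i))) ⟩
  sumᶠ (λ i → sumᶠ (λ k → a i * (z k * F k i)))
    ≡⟨ sum-swap (λ i k → a i * (z k * F k i)) ⟩
  sumᶠ (λ k → sumᶠ (λ i → a i * (z k * F k i)))
    ≡⟨ sum-cong (λ k → trans (sum-cong (λ i → swap (a i) (z k) (F k i))) (sum-*ˡ (z k) (λ i → a i * F k i))) ⟩
  sumᶠ (λ k → z k * dot a (F k))
    ∎
  where
  open ≡-Reasoning
  swap : ∀ a z f → a * (z * f) ≡ z * (a * f)
  swap = solve-∀

-- Congruences and residues

infix 4 _≡_mod_
record _≡_mod_ (x y : ℤ) (m : ℕ) : Set where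
  constructor mod-intro
  field divides-difference : + m S.∣ (x - y)
open _≡_mod_ public

module _ {m : ℕ} where

  mod-reflexive : ∀ {x y} → x ≡ y → x ≡ y mod m
  mod-reflexive {x} refl = mod-intro (subst (+ m S.∣_) (sym (ℤP.+-inverseʳ x)) (S.divides (+ 0) refl))

  mod-refl : ∀ {x} → x ≡ x mod m
  mod-refl = mod-reflexive refl

  mod-sym : ∀ {x y} → x ≡ y mod m → y ≡ x mod m
  mod-sym {x} {y} (mod-intro m∣x-y) = mod-intro (subst (+ m S.∣_) (negate x y) (S.∣m⇒∣-m m∣x-y))
    where
    negate : ∀ x y → - (x - y) ≡ y - x
    negate = solve-∀

  mod-trans : ∀ {x y z} → x ≡ y mod m → y ≡ z mod m → x ≡ z mod m
  mod-trans {x} {y} {z} (mod-intro m∣x-y) (mod-intro m∣y-z) =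
    mod-intro (subst (+ m S.∣_) (telescope x y z) (S.∣m∣n⇒∣m+n m∣x-y m∣y-z))
    where
    telescope : ∀ x y z → (x - y) + (y - z) ≡ x - z
    telescope = solve-∀

  mod-+ : ∀ {x x′ y y′} → x ≡ x′ mod m → y ≡ y′ mod m → x + y ≡ x′ + y′ mod m
  mod-+ {x} {x′} {y} {y′} (mod-intro m∣x-x′) (mod-intro m∣y-y′) =
    mod-intro (subst (+ m S.∣_) (regroup x x′ y y′) (S.∣m∣n⇒∣m+n m∣x-x′ m∣y-y′))
    where
    regroup : ∀ x x′ y y′ → (x - x′) + (y - y′) ≡ (x + y) - (x′ + y′)
    regroup = solve-∀

  mod-* : ∀ {x x′ y y′} → x ≡ x′ mod m → y ≡ y′ mod m → x * y ≡ x′ * y′ mod m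
  mod-* {x} {x′} {y} {y′} (mod-intro m∣x-x′) (mod-intro m∣y-y′) =
    mod-intro (subst (+ m S.∣_) (regroup x x′ y y′)
                     (S.∣m∣n⇒∣m+n (S.∣m⇒∣m*n y m∣x-x′) (S.∣n⇒∣m*n x′ m∣y-y′)))
    where
    regroup : ∀ x x′ y y′ → (x - x′) * y + x′ * (y - y′) ≡ x * y - x′ * y′
    regroup = solve-∀

  mod-*ˡ : ∀ c {y y′} → y ≡ y′ mod m → c * y ≡ c * y′ mod m
  mod-*ˡ c = mod-* (mod-refl {c})

  mod-neg : ∀ {x x′} → x ≡ x′ mod m → - x ≡ - x′ mod m
  mod-neg {x} {x′} (mod-intro m∣x-x′) = mod-intro (subst (+ m S.∣_) (negate x x′) (S.∣m⇒∣-m m∣x-x′))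
    where
    negate : ∀ x x′ → - (x - x′) ≡ - x - - x′
    negate = solve-∀

  divisible⇒≡0 : ∀ {x} → + m S.∣ x → x ≡ + 0 mod m
  divisible⇒≡0 {x} m∣x = mod-intro (subst (+ m S.∣_) (sym (ℤP.+-identityʳ x)) m∣x)

  ≡0⇒divisible : ∀ {x} → x ≡ + 0 mod m → + m S.∣ x
  ≡0⇒divisible {x} (mod-intro m∣x-0) = subst (+ m S.∣_) (ℤP.+-identityʳ x) m∣x-0

  multiple≡0 : ∀ x → + m * x ≡ + 0 mod m
  multiple≡0 x = divisible⇒≡0 (S.∣m⇒∣m*n x (S.∣-refl {+ m}))

  mod-cancelˡ : ∀ {x y y′} → x + y ≡ x + y′ mod m → y ≡ y′ mod m
  mod-cancelˡ {x} {y} {y′} (mod-intro m∣diff) = mod-intro (subst (+ m S.∣_) (cancel x y y′) m∣diff)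
    where
    cancel : ∀ x y y′ → (x + y) - (x + y′) ≡ y - y′
    cancel = solve-∀

  sum-mod : ∀ {n} {f g : Vz n} → (∀ i → f i ≡ g i mod m) → sumᶠ f ≡ sumᶠ g mod m
  sum-mod {zero}  f≡g = mod-refl
  sum-mod {suc n} f≡g = mod-+ (f≡g zero) (sum-mod (λ i → f≡g (suc i)))

mod-setoid : ℕ → Setoid _ _
mod-setoid m = record
  { Carrier = ℤ
  ; _≈_ = λ x y → x ≡ y mod m
  ; isEquivalence = record { refl = mod-refl ; sym = mod-sym ; trans = mod-trans } }

module ModReasoning (m : ℕ) = SetoidReasoning (mod-setoid m)

rep-≡ : ∀ m x → x ≡ + rep (suc m) x mod suc m
rep-≡ m x = mod-intro (S.divides (x /ℕ suc m) (trans (cong (_- + (x %ℕ suc m)) (ℤDM.a≡a%ℕn+[a/ℕn]*n x (suc m)))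
                                                      (cancel (+ (x %ℕ suc m)) _)))
  where
  cancel : ∀ a b → a + b - a ≡ b
  cancel = solve-∀

rep-< : ∀ m x → rep (suc m) x ℕ.< suc m
rep-< m x = ℤDM.n%ℕd<d x (suc m)

rep-unique : ∀ {μ r₁ r₂} → r₁ ℕ.< μ → r₂ ℕ.< μ → + r₁ ≡ + r₂ mod μ → r₁ ≡ r₂
rep-unique {μ} {r₁} {r₂} r₁<μ r₂<μ (mod-intro μ∣r₁-r₂) with ℤ.∣ + r₁ - + r₂ ∣ in d≡
... | zero  = ℤP.+-injective (ℤP.i-j≡0⇒i≡j (+ r₁) (+ r₂) (ℤP.∣i∣≡0⇒i≡0 d≡))
... | suc d = ⊥-elim (ℕP.<⇒≱ d<μ (ℕD.∣⇒≤ (subst (μ ℕD.∣_) d≡ (S.∣⇒∣ᵤ μ∣r₁-r₂))))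
  where
  d<μ : suc d ℕ.< μ
  d<μ = ℕP.≤-<-trans (subst (ℕ._≤ r₁ ℕ.⊔ r₂) (trans (cong ℤ.∣_∣ (sym (ℤP.m-n≡m⊖n r₁ r₂))) d≡)
                            (ℤP.∣m⊝n∣≤m⊔n r₁ r₂))
                     (ℕP.⊔-lub r₁<μ r₂<μ)

rep-cong : ∀ m {x y} → x ≡ y mod suc m → rep (suc m) x ≡ rep (suc m) y
rep-cong m {x} {y} x≡y = rep-unique (rep-< m x) (rep-< m y)
  (mod-trans (mod-sym (rep-≡ m x)) (mod-trans x≡y (rep-≡ m y)))

rep-injective : ∀ m {x y} → rep (suc m) x ≡ rep (suc m) y → x ≡ y mod suc m
rep-injective m {x} {y} eq = mod-trans (rep-≡ m x) (mod-trans (mod-reflexive (cong +_ eq)) (mod-sym (rep-≡ m y)))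

-- Equality in G

infix 4 _≈[_]_
record _≈[_]_ {r : ℕ} (g : G r) (μ : Fin r → ℕ) (h : G r) : Set where
  constructor mk≈
  field
    weight-≡  : proj₁ g ≡ proj₁ h
    torsion-≡ : ∀ k → proj₂ g k ≡ proj₂ h k mod μ k
open _≈[_]_ public

infixr 7 _·G_
_·G_ : ∀ {r} → ℤ → G r → G r
c ·G g = c * proj₁ g , λ k → c * proj₂ g k

-G_ : ∀ {r} → G r → G r
-G g = - proj₁ g , λ k → - proj₂ g k

module _ {r : ℕ} (μ : Fin r → ℕ) where

  ≈⇒Eq : ∀ {g h} → g ≈[ μ ] h → Eq μ g h
  ≈⇒Eq (mk≈ w≡ t≡) = w≡ , λ k → S.∣⇒∣ᵤ (divides-difference (t≡ k))

  Eq⇒≈ : ∀ {g h} → Eq μ g h → g ≈[ μ ] h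
  Eq⇒≈ (w≡ , t≡) = mk≈ w≡ (λ k → mod-intro (S.∣ᵤ⇒∣ (t≡ k)))

  ≈-pointwise : ∀ {g h} → proj₁ g ≡ proj₁ h → (∀ k → proj₂ g k ≡ proj₂ h k) → g ≈[ μ ] h
  ≈-pointwise w≡ t≡ = mk≈ w≡ (λ k → mod-reflexive (t≡ k))

  ≈-refl : ∀ {g} → g ≈[ μ ] g
  ≈-refl = ≈-pointwise refl (λ k → refl)

  ≈-sym : ∀ {g h} → g ≈[ μ ] h → h ≈[ μ ] g
  ≈-sym (mk≈ w≡ t≡) = mk≈ (sym w≡) (λ k → mod-sym (t≡ k))

  ≈-trans : ∀ {g h i} → g ≈[ μ ] h → h ≈[ μ ] i → g ≈[ μ ] i
  ≈-trans (mk≈ w≡ t≡) (mk≈ w≡′ t≡′) = mk≈ (trans w≡ w≡′) (λ k → mod-trans (t≡ k) (t≡′ k))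

  G-setoid : Setoid _ _
  G-setoid = record
    { Carrier = G r
    ; _≈_ = _≈[ μ ]_
    ; isEquivalence = record { refl = ≈-refl ; sym = ≈-sym ; trans = ≈-trans } }

  +G-cong : ∀ {g g′ h h′} → g ≈[ μ ] g′ → h ≈[ μ ] h′ → g +G h ≈[ μ ] g′ +G h′
  +G-cong (mk≈ w≡ t≡) (mk≈ w≡′ t≡′) = mk≈ (cong₂ _+_ w≡ w≡′) (λ k → mod-+ (t≡ k) (t≡′ k))

  ·G-cong : ∀ c {g g′} → g ≈[ μ ] g′ → c ·G g ≈[ μ ] c ·G g′
  ·G-cong c (mk≈ w≡ t≡) = mk≈ (cong (c *_) w≡) (λ k → mod-*ˡ c (t≡ k))

  -G-cong : ∀ {g g′} → g ≈[ μ ] g′ → -G g ≈[ μ ] -G g′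
  -G-cong (mk≈ w≡ t≡) = mk≈ (cong -_ w≡) (λ k → mod-neg (t≡ k))

  combG-cong : ∀ {m} {x y : Vz m} (Q : Fin m → G r) → (∀ i → x i ≡ y i) → combG x Q ≈[ μ ] combG y Q
  combG-cong Q x≗y = ≈-pointwise (sum-cong (λ i → cong (_* _) (x≗y i)))
                                 (λ k → sum-cong (λ i → cong (_* _) (x≗y i)))

  combG-+ : ∀ {m} (x y : Vz m) (Q : Fin m → G r) →
            combG (λ i → x i + y i) Q ≈[ μ ] combG x Q +G combG y Q
  combG-+ x y Q = ≈-pointwise (distrib (λ i → proj₁ (Q i))) (λ k → distrib (λ i → proj₂ (Q i) k))
    where
    distrib : ∀ q → sumᶠ (λ i → (x i + y i) * q i) ≡ sumᶠ (λ i → x i * q i) + sumᶠ (λ i → y i * q i)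
    distrib q = trans (sum-cong (λ i → ℤP.*-distribʳ-+ (q i) (x i) (y i))) (sum-+ (λ i → x i * q i) (λ i → y i * q i))

  combG-· : ∀ {m} (c : ℤ) (x : Vz m) (Q : Fin m → G r) →
            combG (λ i → c * x i) Q ≈[ μ ] c ·G combG x Q
  combG-· c x Q = ≈-pointwise (assoc (λ i → proj₁ (Q i))) (λ k → assoc (λ i → proj₂ (Q i) k))
    where
    assoc : ∀ q → sumᶠ (λ i → c * x i * q i) ≡ c * sumᶠ (λ i → x i * q i)
    assoc q = trans (sum-cong (λ i → ℤP.*-assoc c (x i) (q i))) (sum-*ˡ c (λ i → x i * q i))

  combG-supported : ∀ {m} (i : Fin m) (y : Vz m) (Q : Fin m → G r) → (∀ j → ¬ j ≡ i → y j ≡ + 0) →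
                    combG y Q ≈[ μ ] y i ·G Q i
  combG-supported i y Q y≗0 = ≈-pointwise (supported (λ j → proj₁ (Q j))) (λ k → supported (λ j → proj₂ (Q j) k))
    where
    supported : ∀ q → sumᶠ (λ j → y j * q j) ≡ y i * q i
    supported q = sum-supported i _ (λ j j≢i → cong (_* q j) (y≗0 j j≢i))

  +G-cancelˡ : ∀ g {h h′} → g +G h ≈[ μ ] g +G h′ → h ≈[ μ ] h′
  +G-cancelˡ g (mk≈ w≡ t≡) = mk≈ (∙-cancelˡ (proj₁ g) _ _ w≡) (λ k → mod-cancelˡ {x = proj₂ g k} (t≡ k))

  +G-identityʳ : ∀ g → g +G 0G ≈[ μ ] g
  +G-identityʳ g = ≈-pointwise (ℤP.+-identityʳ _) (λ k → ℤP.+-identityʳ _)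

  ·G-zeroʳ : ∀ c → c ·G 0G ≈[ μ ] 0G
  ·G-zeroʳ c = ≈-pointwise (ℤP.*-zeroʳ c) (λ k → ℤP.*-zeroʳ c)

  +G-inverseʳ : ∀ g → g +G (-G g) ≈[ μ ] 0G
  +G-inverseʳ g = ≈-pointwise (ℤP.+-inverseʳ (proj₁ g)) (λ k → ℤP.+-inverseʳ (proj₂ g k))

-- Integral linear algebra

abs-as-multiple : ∀ a → ∃[ σ ] + ℤ.∣ a ∣ ≡ σ * a
abs-as-multiple (+ n)      = + 1 , sym (ℤP.*-identityˡ (+ n))
abs-as-multiple ℤ.-[1+ n ] = - + 1 , sym (ℤP.-1*i≡-i ℤ.-[1+ n ])

ℕ-identity⇒ℤ : ∀ {d p q} x y → d ℕ.+ y ℕ.* q ≡ x ℕ.* p → + d ≡ + x * + p - + y * + q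
ℕ-identity⇒ℤ {d} {p} {q} x y eq = begin
  + d                          ≡⟨ add-sub (+ d) (+ y * + q) ⟩
  + d + + y * + q - + y * + q  ≡⟨ cong (_- + y * + q) cast ⟩
  + x * + p - + y * + q        ∎
  where
  open ≡-Reasoning
  add-sub : ∀ a b → a ≡ a + b - b
  add-sub = solve-∀
  cast : + d + + y * + q ≡ + x * + p
  cast = trans (cong (_+_ (+ d)) (sym (ℤP.pos-* y q)))
               (trans (sym (ℤP.pos-+ d (y ℕ.* q))) (trans (cong +_ eq) (ℤP.pos-* x p)))

gcd-linear-combination : ∀ a b → ∃[ s ] ∃[ t ] ℤGCD.gcd a b ≡ s * a + t * b
gcd-linear-combination a b with abs-as-multiple a | abs-as-multiple b
                              | ℕGCD.Bézout.identity (gcd-GCD ℤ.∣ a ∣ ℤ.∣ b ∣)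
... | σ , ∣a∣≡σa | τ , ∣b∣≡τb | ℕGCD.Bézout.+- x y eq =
  + x * σ , - (+ y * τ) ,
  trans (ℕ-identity⇒ℤ x y eq)
        (trans (cong₂ (λ u v → + x * u - + y * v) ∣a∣≡σa ∣b∣≡τb) (regroup (+ x) σ a (+ y) τ b))
  where
  regroup : ∀ x σ a y τ b → x * (σ * a) - y * (τ * b) ≡ x * σ * a + - (y * τ) * b
  regroup = solve-∀
... | σ , ∣a∣≡σa | τ , ∣b∣≡τb | ℕGCD.Bézout.-+ x y eq =
  - (+ x * σ) , + y * τ ,
  trans (ℕ-identity⇒ℤ y x eq)
        (trans (cong₂ (λ u v → + y * v - + x * u) ∣a∣≡σa ∣b∣≡τb) (regroup (+ x) σ a (+ y) τ b))
  where
  regroup : ∀ x σ a y τ b → y * (τ * b) - x * (σ * a) ≡ - (x * σ) * a + y * τ * b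
  regroup = solve-∀

record Bézout (a b : ℤ) : Set where
  field
    d a′ b′ s t : ℤ
    a≡da′ : a ≡ d * a′
    b≡db′ : b ≡ d * b′
    sa′+tb′≡1 : s * a′ + t * b′ ≡ + 1

module _ {a b : ℤ} where

  nonzero-common-divisor⇒bézout : ∀ d .{{_ : ℤ.NonZero d}} → d S.∣ a → d S.∣ b →
                                  (∃[ s ] ∃[ t ] d ≡ s * a + t * b) → Bézout a b
  nonzero-common-divisor⇒bézout d (S.divides a′ a≡a′d) (S.divides b′ b≡b′d) (s , t , d≡sa+tb) = record
    { d = d ; a′ = a′ ; b′ = b′ ; s = s ; t = t
    ; a≡da′ = trans a≡a′d (ℤP.*-comm a′ d) ; b≡db′ = trans b≡b′d (ℤP.*-comm b′ d)
    ; sa′+tb′≡1 = ℤP.*-cancelˡ-≡ d _ _ (begin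
        d * (s * a′ + t * b′)       ≡⟨ regroup d s t a′ b′ ⟩
        s * (a′ * d) + t * (b′ * d) ≡⟨ cong₂ (λ u v → s * u + t * v) a≡a′d b≡b′d ⟨
        s * a + t * b               ≡⟨ d≡sa+tb ⟨
        d                           ≡⟨ ℤP.*-identityʳ d ⟨
        d * + 1                     ∎) }
    where
    open ≡-Reasoning
    regroup : ∀ d s t a′ b′ → d * (s * a′ + t * b′) ≡ s * (a′ * d) + t * (b′ * d)
    regroup = solve-∀

  common-divisor⇒bézout : ∀ d → d S.∣ a → d S.∣ b → (∃[ s ] ∃[ t ] d ≡ s * a + t * b) → Bézout a b
  common-divisor⇒bézout (+ 0) (S.divides a′ a≡a′0) (S.divides b′ b≡b′0) _ = record
    { d = + 0 ; a′ = + 1 ; b′ = + 0 ; s = + 1 ; t = + 0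
    ; a≡da′ = trans a≡a′0 (ℤP.*-zeroʳ a′) ; b≡db′ = trans b≡b′0 (ℤP.*-zeroʳ b′)
    ; sa′+tb′≡1 = refl }
  common-divisor⇒bézout d@(ℤ.+[1+ _ ]) = nonzero-common-divisor⇒bézout d
  common-divisor⇒bézout d@(ℤ.-[1+ _ ]) = nonzero-common-divisor⇒bézout d

bézout : ∀ a b → Bézout a b
bézout a b = common-divisor⇒bézout (ℤGCD.gcd a b)
                                   (S.∣ᵤ⇒∣ (ℤGCD.gcd[i,j]∣i a b)) (S.∣ᵤ⇒∣ (ℤGCD.gcd[i,j]∣j a b))
                                   (gcd-linear-combination a b)

record LinMap (m p : ℕ) : Set where
  field
    apply   : Vz m → Vz p
    apply-cong : ∀ {x y} → (∀ k → x k ≡ y k) → ∀ k → apply x k ≡ apply y k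
    apply-+ : ∀ x y k → apply (λ i → x i + y i) k ≡ apply x k + apply y k
    apply-· : ∀ c x k → apply (λ i → c * x i) k ≡ c * apply x k
open LinMap public

apply-0 : ∀ {m p} (L : LinMap m p) k → apply L (λ _ → + 0) k ≡ + 0
apply-0 L k = apply-· L (+ 0) (λ _ → + 0) k

apply-combination : ∀ {m p q} (L : LinMap m p) (c : Vz q) (F : Fin q → Vz m) k →
                    apply L (λ i → sumᶠ (λ j → c j * F j i)) k ≡ sumᶠ (λ j → c j * apply L (F j) k)
apply-combination {q = zero}  L c F k = apply-0 L k
apply-combination {q = suc q} L c F k = begin
  apply L (λ i → c zero * F zero i + sumᶠ (λ j → c (suc j) * F (suc j) i)) k
    ≡⟨ apply-+ L _ _ k ⟩
  apply L (λ i → c zero * F zero i) k + apply L (λ i → sumᶠ (λ j → c (suc j) * F (suc j) i)) k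
    ≡⟨ cong₂ _+_ (apply-· L (c zero) (F zero) k) (apply-combination L (tail c) (λ j → F (suc j)) k) ⟩
  c zero * apply L (F zero) k + sumᶠ (λ j → c (suc j) * apply L (F (suc j)) k) ∎
  where open ≡-Reasoning

apply-expand : ∀ {m p} (L : LinMap m p) (y : Vz m) k → apply L y k ≡ sumᶠ (λ j → y j * apply L (e j) k)
apply-expand L y k = trans (apply-cong L (λ i → sym (sum-eʳ i y)) k) (apply-combination L y e k)

infixr 9 _∘L_
_∘L_ : ∀ {m p q} → LinMap p q → LinMap m p → LinMap m q
L ∘L K = record
  { apply = λ x → apply L (apply K x)
  ; apply-cong = λ x≗y → apply-cong L (apply-cong K x≗y)
  ; apply-+ = λ x y k → trans (apply-cong L (apply-+ K x y) k) (apply-+ L _ _ k)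
  ; apply-· = λ c x k → trans (apply-cong L (apply-· K c x) k) (apply-· L c _ k) }

record LinIso (m : ℕ) : Set where
  field
    U U⁻¹ : LinMap m m
    U-U⁻¹ : ∀ x k → apply U (apply U⁻¹ x) k ≡ x k
    U⁻¹-U : ∀ x k → apply U⁻¹ (apply U x) k ≡ x k
open LinIso public

idL : ∀ {m} → LinMap m m
idL = record { apply = λ x → x ; apply-cong = λ x≗y → x≗y ; apply-+ = λ x y k → refl ; apply-· = λ c x k → refl }

idI : ∀ {m} → LinIso m
idI = record { U = idL ; U⁻¹ = idL ; U-U⁻¹ = λ x k → refl ; U⁻¹-U = λ x k → refl }

infixr 9 _∘I_
_∘I_ : ∀ {m} → LinIso m → LinIso m → LinIso m
A ∘I B = record
  { U = U A ∘L U B ; U⁻¹ = U⁻¹ B ∘L U⁻¹ A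
  ; U-U⁻¹ = λ x k → trans (apply-cong (U A) (U-U⁻¹ B (apply (U⁻¹ A) x)) k) (U-U⁻¹ A x k)
  ; U⁻¹-U = λ x k → trans (apply-cong (U⁻¹ B) (U⁻¹-U A (apply (U B) x)) k) (U⁻¹-U B x k) }

liftL : ∀ {m} → LinMap m m → LinMap (suc m) (suc m)
liftL L = record
  { apply = λ x → λ { zero → x zero ; (suc k) → apply L (tail x) k }
  ; apply-cong = λ { x≗y zero → x≗y zero ; x≗y (suc k) → apply-cong L (λ i → x≗y (suc i)) k }
  ; apply-+ = λ { x y zero → refl ; x y (suc k) → apply-+ L _ _ k }
  ; apply-· = λ { c x zero → refl ; c x (suc k) → apply-· L c _ k } }

liftI : ∀ {m} → LinIso m → LinIso (suc m)
liftI A = record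
  { U = liftL (U A) ; U⁻¹ = liftL (U⁻¹ A)
  ; U-U⁻¹ = λ { x zero → refl ; x (suc k) → U-U⁻¹ A (tail x) k }
  ; U⁻¹-U = λ { x zero → refl ; x (suc k) → U⁻¹-U A (tail x) k } }

block : ∀ {m} (α β γ δ : ℤ) → LinMap (suc (suc m)) (suc (suc m))
block α β γ δ = record
  { apply = λ x → λ { zero → α * x zero + β * x (suc zero)
                    ; (suc zero) → γ * x zero + δ * x (suc zero)
                    ; (suc (suc k)) → x (suc (suc k)) }
  ; apply-cong = λ { x≗y zero → cong₂ (λ u v → α * u + β * v) (x≗y zero) (x≗y (suc zero))
                   ; x≗y (suc zero) → cong₂ (λ u v → γ * u + δ * v) (x≗y zero) (x≗y (suc zero))
                   ; x≗y (suc (suc k)) → x≗y (suc (suc k)) }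
  ; apply-+ = λ { x y zero → distrib α β (x zero) (y zero) (x (suc zero)) (y (suc zero))
                ; x y (suc zero) → distrib γ δ (x zero) (y zero) (x (suc zero)) (y (suc zero))
                ; x y (suc (suc k)) → refl }
  ; apply-· = λ { c x zero → commute c α β (x zero) (x (suc zero))
                ; c x (suc zero) → commute c γ δ (x zero) (x (suc zero))
                ; c x (suc (suc k)) → refl } }
  where
  distrib : ∀ α β x₀ y₀ x₁ y₁ →
            α * (x₀ + y₀) + β * (x₁ + y₁) ≡ (α * x₀ + β * x₁) + (α * y₀ + β * y₁)
  distrib = solve-∀
  commute : ∀ c α β x₀ x₁ → α * (c * x₀) + β * (c * x₁) ≡ c * (α * x₀ + β * x₁)
  commute = solve-∀

unimodularBlock : ∀ {m} s t a′ b′ → s * a′ + t * b′ ≡ + 1 → LinIso (suc (suc m))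
unimodularBlock s t a′ b′ det = record
  { U = block s (- b′) t a′ ; U⁻¹ = block a′ b′ (- t) s
  ; U-U⁻¹ = λ { x zero → scaled (inverse₀ s t a′ b′ (x zero) (x (suc zero)))
                ; x (suc zero) → scaled (inverse₁ s t a′ b′ (x zero) (x (suc zero)))
                ; x (suc (suc k)) → refl }
  ; U⁻¹-U = λ { x zero → scaled (inverse₂ s t a′ b′ (x zero) (x (suc zero)))
                ; x (suc zero) → scaled (inverse₃ s t a′ b′ (x zero) (x (suc zero)))
                ; x (suc (suc k)) → refl } }
  where
  scaled : ∀ {lhs x} → lhs ≡ (s * a′ + t * b′) * x → lhs ≡ x
  scaled {x = x} eq = trans eq (trans (cong (_* x) det) (ℤP.*-identityˡ x))
  inverse₀ : ∀ s t a b x₀ x₁ → s * (a * x₀ + b * x₁) + - b * (- t * x₀ + s * x₁) ≡ (s * a + t * b) * x₀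
  inverse₀ = solve-∀
  inverse₁ : ∀ s t a b x₀ x₁ → t * (a * x₀ + b * x₁) + a * (- t * x₀ + s * x₁) ≡ (s * a + t * b) * x₁
  inverse₁ = solve-∀
  inverse₂ : ∀ s t a b x₀ x₁ → a * (s * x₀ + - b * x₁) + b * (t * x₀ + a * x₁) ≡ (s * a + t * b) * x₀
  inverse₂ = solve-∀
  inverse₃ : ∀ s t a b x₀ x₁ → - t * (s * x₀ + - b * x₁) + s * (t * x₀ + a * x₁) ≡ (s * a + t * b) * x₁
  inverse₃ = solve-∀

-- The tail of a is reduced to g′ y₁ first; a unimodular block from Bézout for (a₀, g′) then merges
-- a₀ y₀ + g′ y₁ into gcd(a₀, g′) y₀.
rowReduce : ∀ m (a : Vz (suc m)) → ∃[ A ] ∃[ g ] (∀ y → dot a (apply (U A) y) ≡ g * y zero)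
rowReduce zero    a = idI , a zero , λ y → ℤP.+-identityʳ _
rowReduce (suc m) a with rowReduce m (tail a)
... | A′ , g′ , reduced with bézout (a zero) g′
... | record { d = d ; a′ = a′ ; b′ = b′ ; s = s ; t = t
             ; a≡da′ = a≡da′ ; b≡db′ = g′≡db′ ; sa′+tb′≡1 = det } =
  liftI A′ ∘I B , d , λ y → begin
    a zero * z y zero + dot (tail a) (apply (U A′) (tail (z y)))
      ≡⟨ cong (_+_ (a zero * z y zero)) (reduced (tail (z y))) ⟩
    a zero * (s * y zero + - b′ * y (suc zero)) + g′ * (t * y zero + a′ * y (suc zero))
      ≡⟨ cong₂ (λ u v → u * (s * y zero + - b′ * y (suc zero)) + v * (t * y zero + a′ * y (suc zero)))
               a≡da′ g′≡db′ ⟩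
    d * a′ * (s * y zero + - b′ * y (suc zero)) + d * b′ * (t * y zero + a′ * y (suc zero))
      ≡⟨ collect d a′ b′ s t (y zero) (y (suc zero)) ⟩
    d * (s * a′ + t * b′) * y zero
      ≡⟨ cong (λ u → d * u * y zero) det ⟩
    d * + 1 * y zero
      ≡⟨ cong (_* y zero) (ℤP.*-identityʳ d) ⟩
    d * y zero ∎
  where
  open ≡-Reasoning
  B = unimodularBlock s t a′ b′ det
  z : Vz (suc (suc m)) → Vz (suc (suc m))
  z = apply (U B)
  collect : ∀ d a b s t y₀ y₁ →
            d * a * (s * y₀ + - b * y₁) + d * b * (t * y₀ + a * y₁) ≡ d * (s * a + t * b) * y₀
  collect = solve-∀

leastWitness : ∀ {P : ℕ → Set} → Decidable P → ∀ {m} → P m → ∃[ k ] (P k × (∀ j → j ℕ.< k → ¬ P j))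
leastWitness {P} P? {m} = <-rec (λ m → P m → ∃[ k ] (P k × (∀ j → j ℕ.< k → ¬ P j))) search m
  where
  search : ∀ m → (∀ {j} → j ℕ.< m → P j → ∃[ k ] (P k × (∀ i → i ℕ.< k → ¬ P i))) →
           P m → ∃[ k ] (P k × (∀ j → j ℕ.< k → ¬ P j))
  search m smaller pm with FinP.any? (λ (j : Fin m) → P? (Fin.toℕ j))
  ... | yes (j , pj) = smaller (FinP.toℕ<n j) pj
  ... | no  none     = m , pm , λ j j<m pj → none (Fin.fromℕ< j<m , subst P (sym (FinP.toℕ-fromℕ< j<m)) pj)

annihilator-generator : ∀ μ → 1 ℕ.≤ μ → ∀ h →
                        ∃[ m₀ ] (1 ℕ.≤ m₀ × h * + m₀ ≡ + 0 mod μ × (∀ z → h * z ≡ + 0 mod μ → + m₀ S.∣ z))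
annihilator-generator μ 1≤μ h with leastWitness P? {μ} (1≤μ , S.∣n⇒∣m*n h (S.∣-refl {+ μ}))
  where
  P : ℕ → Set
  P j = 1 ℕ.≤ j × + μ S.∣ h * + j
  P? : Decidable P
  P? j with 1 ℕ.≤? j | + μ S.∣? h * + j
  ... | yes 1≤j | yes μ∣hj = yes (1≤j , μ∣hj)
  ... | no  1≰j | _        = no (λ p → 1≰j (proj₁ p))
  ... | _       | no  μ∤hj = no (λ p → μ∤hj (proj₂ p))
... | zero , (() , _) , _
... | m₀@(suc _) , (1≤m₀ , μ∣hm₀) , minimal = m₀ , 1≤m₀ , divisible⇒≡0 μ∣hm₀ , divides
  where
  divides : ∀ z → h * z ≡ + 0 mod μ → + m₀ S.∣ z
  divides z hz≡0 with z %ℕ m₀ in r≡ | ℤDM.a≡a%ℕn+[a/ℕn]*n z m₀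
  ... | zero  | z≡r+qm₀ = S.divides (z /ℕ m₀) (trans z≡r+qm₀ (ℤP.+-identityˡ _))
  ... | suc r | z≡r+qm₀ = ⊥-elim (minimal (suc r) r<m₀ (ℕ.s≤s ℕ.z≤n , ≡0⇒divisible hr≡0))
    where
    q : ℤ
    q = z /ℕ m₀
    r<m₀ : suc r ℕ.< m₀
    r<m₀ = subst (ℕ._< m₀) r≡ (ℤDM.n%ℕd<d z m₀)
    remainder : ∀ h z r q m → z ≡ r + q * m → h * r ≡ h * z + - q * (h * m)
    remainder h z r q m z≡ = trans (expand h r q m) (cong (λ u → h * u + - q * (h * m)) (sym z≡))
      where
      expand : ∀ h r q m → h * r ≡ h * (r + q * m) + - q * (h * m)
      expand = solve-∀
    hr≡0 : h * + suc r ≡ + 0 mod μ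
    hr≡0 = begin
      h * + suc r                     ≡⟨ remainder h z (+ suc r) q (+ m₀) z≡r+qm₀ ⟩
      h * z + - q * (h * + m₀)        ≈⟨ mod-+ hz≡0 (mod-*ˡ (- q) (divisible⇒≡0 μ∣hm₀)) ⟩
      + 0 + - q * + 0                 ≡⟨ trans (ℤP.+-identityˡ _) (ℤP.*-zeroʳ (- q)) ⟩
      + 0                             ∎
      where open ModReasoning μ

record IsBasisOf {m p} (Φ : LinMap m p) (S : Vz p → Set) : Set where
  field
    basis-in          : ∀ c → S (apply Φ c)
    basis-spans       : ∀ x → S x → ∃[ c ] (∀ i → x i ≡ apply Φ c i)
    basis-independent : ∀ c → (∀ i → apply Φ c i ≡ + 0) → ∀ k → c k ≡ + 0
open IsBasisOf public

matrix : ∀ {m p} → LinMap m p → Mat m p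
matrix Φ k i = apply Φ (e k) i

basis-∘ : ∀ {m p q} {Φ : LinMap p q} {Ψ : LinMap m p} {S S′ : Vz q → Set} →
          (∀ {x y} → (∀ i → x i ≡ y i) → S′ x → S′ y) →
          IsBasisOf Φ S → IsBasisOf Ψ (λ c → S′ (apply Φ c)) → IsBasisOf (Φ ∘L Ψ) (λ x → S x × S′ x)
basis-∘ {Φ = Φ} {Ψ} {S} {S′} S′-resp Φ-basis Ψ-basis = record
  { basis-in = λ d → basis-in Φ-basis (apply Ψ d) , basis-in Ψ-basis d
  ; basis-spans = spans
  ; basis-independent = λ d ΦΨd≡0 → basis-independent Ψ-basis d (basis-independent Φ-basis _ ΦΨd≡0) }
  where
  spans : ∀ x → S x × S′ x → ∃[ d ] (∀ i → x i ≡ apply (Φ ∘L Ψ) d i)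
  spans x (x∈S , x∈S′) with basis-spans Φ-basis x x∈S
  ... | c , x≗Φc with basis-spans Ψ-basis c (S′-resp x≗Φc x∈S′)
  ... | d , c≗Ψd = d , λ i → trans (x≗Φc i) (apply-cong Φ c≗Ψd i)

basis-⇔ : ∀ {m p} {Φ : LinMap m p} {S S′ : Vz p → Set} →
          (∀ x → S x → S′ x) → (∀ x → S′ x → S x) → IsBasisOf Φ S → IsBasisOf Φ S′
basis-⇔ S⇒S′ S′⇒S basis = record
  { basis-in = λ c → S⇒S′ _ (basis-in basis c)
  ; basis-spans = λ x x∈S′ → basis-spans basis x (S′⇒S x x∈S′)
  ; basis-independent = basis-independent basis }

basis⇒kernelBasis : ∀ {n r} {μ : Fin r → ℕ} {Q : Fin (suc n) → G r} {Φ : LinMap n (suc n)} →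
                    IsBasisOf Φ (λ x → combG x Q ≈[ μ ] 0G) → KernelBasis μ Q (matrix Φ)
basis⇒kernelBasis {μ = μ} {Q} {Φ} basis =
    (λ k → ≈⇒Eq μ (basis-in basis (e k)))
  , (λ x x∈ker → let (c , x≗Φc) = basis-spans basis x (Eq⇒≈ μ x∈ker)
                 in c , λ i → trans (x≗Φc i) (apply-expand Φ c i))
  , (λ c Σ≡0 → basis-independent basis c (λ i → trans (apply-expand Φ c i) (Σ≡0 i)))

embed : ∀ {n} → LinMap n (suc n)
embed = record
  { apply = + 0 ∷_
  ; apply-cong = λ { x≗y zero → refl ; x≗y (suc k) → x≗y k }
  ; apply-+ = λ { x y zero → refl ; x y (suc k) → refl }
  ; apply-· = λ { c x zero → sym (ℤP.*-zeroʳ c) ; c x (suc k) → refl } }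

scaleFirst : ∀ {n} → ℤ → LinMap (suc n) (suc n)
scaleFirst m = record
  { apply = λ z → λ { zero → m * z zero ; (suc k) → z (suc k) }
  ; apply-cong = λ { x≗y zero → cong (m *_) (x≗y zero) ; x≗y (suc k) → x≗y (suc k) }
  ; apply-+ = λ { x y zero → ℤP.*-distribˡ-+ m (x zero) (y zero) ; x y (suc k) → refl }
  ; apply-· = λ { c x zero → commute m c (x zero) ; c x (suc k) → refl } }
  where
  commute : ∀ m c x → m * (c * x) ≡ c * (m * x)
  commute = solve-∀

nonzero-factor : ∀ g y → g * y ≡ + 0 → ¬ g ≡ + 0 → y ≡ + 0
nonzero-factor g y gy≡0 g≢0 with ℤP.i*j≡0⇒i≡0∨j≡0 g gy≡0
... | inj₁ g≡0 = ⊥-elim (g≢0 g≡0)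
... | inj₂ y≡0 = y≡0

module _ {m : ℕ} (w : Vz (suc m)) (A : LinIso (suc m)) (g : ℤ)
         (reduced : ∀ y → dot w (apply (U A) y) ≡ g * y zero) where

  dot-via-inverse : ∀ x → dot w x ≡ g * apply (U⁻¹ A) x zero
  dot-via-inverse x = trans (sym (dot-congʳ w (U-U⁻¹ A x))) (reduced (apply (U⁻¹ A) x))

  reduction⇒weightKernelBasis : ¬ g ≡ + 0 → IsBasisOf (U A ∘L embed) (λ x → dot w x ≡ + 0)
  reduction⇒weightKernelBasis g≢0 = record
    { basis-in = λ c → trans (reduced (+ 0 ∷ c)) (ℤP.*-zeroʳ g)
    ; basis-spans = spans
    ; basis-independent = λ c Φc≡0 k → trans (sym (U⁻¹-U A (+ 0 ∷ c) (suc k)))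
                                             (trans (apply-cong (U⁻¹ A) Φc≡0 (suc k)) (apply-0 (U⁻¹ A) (suc k))) }
    where
    spans : ∀ x → dot w x ≡ + 0 → ∃[ c ] (∀ i → x i ≡ apply (U A) (+ 0 ∷ c) i)
    spans x wx≡0 = tail y , λ i → trans (sym (U-U⁻¹ A x i)) (apply-cong (U A) y≗0∷tail i)
      where
      y = apply (U⁻¹ A) x
      y₀≡0 : y zero ≡ + 0
      y₀≡0 = nonzero-factor g (y zero) (trans (sym (dot-via-inverse x)) wx≡0) g≢0
      y≗0∷tail : ∀ i → y i ≡ (+ 0 ∷ tail y) i
      y≗0∷tail zero    = y₀≡0
      y≗0∷tail (suc i) = refl

weightKernel-basis : ∀ {n} (w : Vz (suc n)) → (∃[ x ] ¬ dot w x ≡ + 0) →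
               ∃[ Φ ] IsBasisOf Φ (λ x → dot w x ≡ + 0)
weightKernel-basis {n} w (x , wx≢0) with rowReduce n w
... | A , g , reduced = U A ∘L embed , reduction⇒weightKernelBasis w A g reduced g≢0
  where
  g≢0 : ¬ g ≡ + 0
  g≢0 g≡0 = wx≢0 (trans (dot-via-inverse w A g reduced x) (trans (cong (_* _) g≡0) refl))

congruenceSublattice-basis : ∀ {m} (b : Vz (suc m)) μ → 1 ℕ.≤ μ →
                       ∃[ Ψ ] IsBasisOf Ψ (λ z → dot b z ≡ + 0 mod μ)
congruenceSublattice-basis {m} b μ 1≤μ with rowReduce m b
... | A , h , reduced with annihilator-generator μ 1≤μ h
... | m₀ , 1≤m₀ , hm₀≡0 , m₀∣ = U A ∘L scaleFirst (+ m₀) , record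
  { basis-in = λ c → mod-trans (mod-reflexive (trans (reduced _) (reassoc h (+ m₀) (c zero)))) (mod-* hm₀≡0 mod-refl)
  ; basis-spans = spans
  ; basis-independent = independent }
  where
  reassoc : ∀ h m c → h * (m * c) ≡ h * m * c
  reassoc = solve-∀
  spans : ∀ z → dot b z ≡ + 0 mod μ → ∃[ c ] (∀ i → z i ≡ apply (U A ∘L scaleFirst (+ m₀)) c i)
  spans z bz≡0 with m₀∣ (apply (U⁻¹ A) z zero)
                       (mod-trans (mod-reflexive (sym (dot-via-inverse b A h reduced z))) bz≡0)
  ... | S.divides q z′₀≡qm₀ = c , λ i → trans (sym (U-U⁻¹ A z i)) (apply-cong (U A) z′≗ i)
    where
    z′ : Vz (suc m)
    z′ = apply (U⁻¹ A) z
    c : Vz (suc m)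
    c zero    = q
    c (suc k) = z′ (suc k)
    z′≗ : ∀ i → z′ i ≡ apply (scaleFirst (+ m₀)) c i
    z′≗ zero    = trans z′₀≡qm₀ (ℤP.*-comm q (+ m₀))
    z′≗ (suc i) = refl
  independent : ∀ c → (∀ i → apply (U A ∘L scaleFirst (+ m₀)) c i ≡ + 0) → ∀ k → c k ≡ + 0
  independent c ΨC≡0 = c≡0
    where
    Dc≡0 : ∀ i → apply (scaleFirst (+ m₀)) c i ≡ + 0
    Dc≡0 i = trans (sym (U⁻¹-U A _ i)) (trans (apply-cong (U⁻¹ A) ΨC≡0 i) (apply-0 (U⁻¹ A) i))
    c≡0 : ∀ k → c k ≡ + 0
    c≡0 zero    = nonzero-factor (+ m₀) (c zero) (Dc≡0 zero)
                                 (λ m₀≡0 → ℕP.<⇒≢ 1≤m₀ (sym (ℤP.+-injective m₀≡0)))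
    c≡0 (suc k) = Dc≡0 (suc k)

weightTorsionKernel-basis : ∀ {n} (w η : Vz (suc (suc n))) μ → 1 ℕ.≤ μ → (∃[ x ] ¬ dot w x ≡ + 0) →
                      ∃[ Φ ] IsBasisOf Φ (λ x → dot w x ≡ + 0 × (dot η x ≡ + 0 mod μ))
weightTorsionKernel-basis w η μ 1≤μ w≢0 = combine (weightKernel-basis w w≢0)
  where
  combine : ∃[ Φ ] IsBasisOf Φ (λ x → dot w x ≡ + 0) →
            ∃[ Φ ] IsBasisOf Φ (λ x → dot w x ≡ + 0 × (dot η x ≡ + 0 mod μ))
  combine (Φ , Φ-basis) = restrict (congruenceSublattice-basis b μ 1≤μ)
    where
    b : Vz _
    b k = dot η (apply Φ (e k))
    η-resp : ∀ {x y} → (∀ i → x i ≡ y i) → dot η x ≡ + 0 mod μ → dot η y ≡ + 0 mod μ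
    η-resp x≗y = mod-trans (mod-reflexive (sym (dot-congʳ η x≗y)))
    η-Φ : ∀ c → dot η (apply Φ c) ≡ dot b c
    η-Φ c = trans (dot-congʳ η (apply-expand Φ c))
                  (trans (dot-combination η c (λ k → apply Φ (e k))) (dot-comm c b))
    restrict : ∃[ Ψ ] IsBasisOf Ψ (λ c → dot b c ≡ + 0 mod μ) →
               ∃[ Φ ] IsBasisOf Φ (λ x → dot w x ≡ + 0 × (dot η x ≡ + 0 mod μ))
    restrict (Ψ , Ψ-basis) =
      Φ ∘L Ψ , basis-∘ {S = λ x → dot w x ≡ + 0} {S′ = λ x → dot η x ≡ + 0 mod μ} η-resp Φ-basis
                       (basis-⇔ {S = λ c → dot b c ≡ + 0 mod μ} {S′ = λ c → dot η (apply Φ c) ≡ + 0 mod μ}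
                                (λ c → mod-trans (mod-reflexive (η-Φ c)))
                                (λ c → mod-trans (mod-reflexive (sym (η-Φ c)))) Ψ-basis)

weightVector-kernelBasis : ∀ {n} (w : Vz (suc n)) → (∃[ x ] ¬ dot w x ≡ + 0) →
                           ∃[ P′ ] KernelBasis noTorsion (asG0 w) P′
weightVector-kernelBasis w w≢0 = kernelBasis (weightKernel-basis w w≢0)
  where
  kernelBasis : ∃[ Φ ] IsBasisOf Φ (λ x → dot w x ≡ + 0) → ∃[ P′ ] KernelBasis noTorsion (asG0 w) P′
  kernelBasis (Φ , basis) =
    matrix Φ , basis⇒kernelBasis {μ = noTorsion} {Q = asG0 w}
                 (basis-⇔ (λ x wx≡0 → mk≈ (trans (dot-comm x w) wx≡0) λ ())
                          (λ x x∈ker → trans (dot-comm w x) (weight-≡ x∈ker)) basis)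

torsionVector-kernelBasis : ∀ {n} (w η : Vz (suc (suc n))) μ → 1 ℕ.≤ μ → (∃[ x ] ¬ dot w x ≡ + 0) →
                            ∃[ P′ ] KernelBasis (oneTorsion μ) (asG1 w η) P′
torsionVector-kernelBasis w η μ 1≤μ w≢0 = kernelBasis (weightTorsionKernel-basis w η μ 1≤μ w≢0)
  where
  to-ker : ∀ x → dot w x ≡ + 0 × (dot η x ≡ + 0 mod μ) → combG x (asG1 w η) ≈[ oneTorsion μ ] 0G
  to-ker x (wx≡0 , ηx≡0) = mk≈ (trans (dot-comm x w) wx≡0) (λ _ → mod-trans (mod-reflexive (dot-comm x η)) ηx≡0)
  from-ker : ∀ x → combG x (asG1 w η) ≈[ oneTorsion μ ] 0G → dot w x ≡ + 0 × (dot η x ≡ + 0 mod μ)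
  from-ker x (mk≈ wx≡0 ηx≡0) = trans (dot-comm w x) wx≡0 , mod-trans (mod-reflexive (dot-comm η x)) (ηx≡0 zero)
  kernelBasis : ∃[ Φ ] IsBasisOf Φ (λ x → dot w x ≡ + 0 × (dot η x ≡ + 0 mod μ)) →
                ∃[ P′ ] KernelBasis (oneTorsion μ) (asG1 w η) P′
  kernelBasis (Φ , basis) = matrix Φ , basis⇒kernelBasis {μ = oneTorsion μ} {Q = asG1 w η} (basis-⇔ to-ker from-ker basis)

-- Automorphisms of G and Gorenstein presentations

module _ {r : ℕ} {μ : Fin r → ℕ} where

  mkAut : (to from : G r → G r) →
          (∀ {g h} → g ≈[ μ ] h → to g ≈[ μ ] to h) → (∀ {g h} → g ≈[ μ ] h → from g ≈[ μ ] from h) →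
          (∀ g h → to (g +G h) ≈[ μ ] to g +G to h) →
          (∀ g → to (from g) ≈[ μ ] g) → (∀ g → from (to g) ≈[ μ ] g) → Aut μ
  mkAut to from to-cong from-cong to-hom to-from from-to = record
    { to = to ; from = from
    ; to-cong = λ g h g≈h → ≈⇒Eq μ (to-cong (Eq⇒≈ μ g≈h))
    ; from-cong = λ g h g≈h → ≈⇒Eq μ (from-cong (Eq⇒≈ μ g≈h))
    ; to-hom = λ g h → ≈⇒Eq μ (to-hom g h)
    ; to-from = λ g → ≈⇒Eq μ (to-from g)
    ; from-to = λ g → ≈⇒Eq μ (from-to g) }

  module AutProperties (φ : Aut μ) where
    open Aut φ using (to; from)
    open SetoidReasoning (G-setoid μ)

    to-cong : ∀ {g h} → g ≈[ μ ] h → to g ≈[ μ ] to h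
    to-cong g≈h = Eq⇒≈ μ (Aut.to-cong φ _ _ (≈⇒Eq μ g≈h))

    from-cong : ∀ {g h} → g ≈[ μ ] h → from g ≈[ μ ] from h
    from-cong g≈h = Eq⇒≈ μ (Aut.from-cong φ _ _ (≈⇒Eq μ g≈h))

    to-+ : ∀ g h → to (g +G h) ≈[ μ ] to g +G to h
    to-+ g h = Eq⇒≈ μ (Aut.to-hom φ g h)

    to-from : ∀ g → to (from g) ≈[ μ ] g
    to-from g = Eq⇒≈ μ (Aut.to-from φ g)

    from-to : ∀ g → from (to g) ≈[ μ ] g
    from-to g = Eq⇒≈ μ (Aut.from-to φ g)

    to-0 : to 0G ≈[ μ ] 0G
    to-0 = +G-cancelˡ μ (to 0G) (begin
      to 0G +G to 0G  ≈⟨ to-+ 0G 0G ⟨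
      to 0G           ≈⟨ +G-identityʳ μ (to 0G) ⟨
      to 0G +G 0G     ∎)

    to-neg : ∀ g → to (-G g) ≈[ μ ] -G (to g)
    to-neg g = +G-cancelˡ μ (to g) (begin
      to g +G to (-G g)  ≈⟨ to-+ g (-G g) ⟨
      to (g +G (-G g))   ≈⟨ to-cong (+G-inverseʳ μ g) ⟩
      to 0G              ≈⟨ to-0 ⟩
      0G                 ≈⟨ +G-inverseʳ μ (to g) ⟨
      to g +G (-G (to g))  ∎)

    to-·ℕ : ∀ k g → to (+ k ·G g) ≈[ μ ] + k ·G to g
    to-·ℕ zero    g = to-0
    to-·ℕ (suc k) g = begin
      to (+ suc k ·G g)        ≈⟨ to-cong (≈-pointwise μ (unfold (proj₁ g)) (λ j → unfold (proj₂ g j))) ⟩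
      to (g +G (+ k ·G g))       ≈⟨ to-+ g (+ k ·G g) ⟩
      to g +G to (+ k ·G g)    ≈⟨ +G-cong μ (≈-refl μ {to g}) (to-·ℕ k g) ⟩
      to g +G (+ k ·G to g)      ≈⟨ ≈-pointwise μ (unfold (proj₁ (to g))) (λ j → unfold (proj₂ (to g) j)) ⟨
      + suc k ·G to g          ∎
      where
      unfold : ∀ x → + suc k * x ≡ x + + k * x
      unfold x = trans (ℤP.*-distribʳ-+ x (+ 1) (+ k)) (cong (_+ + k * x) (ℤP.*-identityˡ x))

    to-· : ∀ c g → to (c ·G g) ≈[ μ ] c ·G to g
    to-· (+ k)      g = to-·ℕ k g
    to-· ℤ.-[1+ k ] g = begin
      to (ℤ.-[1+ k ] ·G g)         ≈⟨ to-cong (≈-pointwise μ (negate (proj₁ g)) (λ j → negate (proj₂ g j))) ⟩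
      to (-G (+ suc k ·G g))       ≈⟨ to-neg (+ suc k ·G g) ⟩
      -G (to (+ suc k ·G g))       ≈⟨ -G-cong μ (to-·ℕ (suc k) g) ⟩
      -G (+ suc k ·G to g)         ≈⟨ ≈-pointwise μ (negate (proj₁ (to g))) (λ j → negate (proj₂ (to g) j)) ⟨
      ℤ.-[1+ k ] ·G to g           ∎
      where
      negate : ∀ x → ℤ.-[1+ k ] * x ≡ - (+ suc k * x)
      negate x = sym (ℤP.neg-distribˡ-* (+ suc k) x)

    to-combG : ∀ {m} (x : Vz m) (Q : Fin m → G r) → to (combG x Q) ≈[ μ ] combG x (λ i → to (Q i))
    to-combG {zero}  x Q = to-0
    to-combG {suc m} x Q = begin
      to ((x zero ·G Q zero) +G combG (tail x) (λ i → Q (suc i)))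
        ≈⟨ to-+ _ _ ⟩
      to (x zero ·G Q zero) +G to (combG (tail x) (λ i → Q (suc i)))
        ≈⟨ +G-cong μ (to-· (x zero) (Q zero)) (to-combG (tail x) (λ i → Q (suc i))) ⟩
      (x zero ·G to (Q zero)) +G combG (tail x) (λ i → to (Q (suc i)))
        ∎

    to-reflects-0 : ∀ {g} → to g ≈[ μ ] 0G → g ≈[ μ ] 0G
    to-reflects-0 {g} tg≈0 = begin
      g              ≈⟨ from-to g ⟨
      from (to g)    ≈⟨ from-cong tg≈0 ⟩
      from 0G        ≈⟨ from-cong to-0 ⟨
      from (to 0G)   ≈⟨ from-to 0G ⟩
      0G             ∎

unit-cancel : ∀ {m} a b u → a * b ≡ + 1 mod m → a * (b * u) ≡ u mod m
unit-cancel {m} a b u ab≡1 = begin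
  a * (b * u)   ≡⟨ ℤP.*-assoc a b u ⟨
  a * b * u     ≈⟨ mod-* ab≡1 (mod-refl {x = u}) ⟩
  + 1 * u       ≡⟨ ℤP.*-identityˡ u ⟩
  u             ∎
  where open ModReasoning m

module _ {r : ℕ} {μ : Fin r → ℕ} where

  shearAut : (a b c : Fin r → ℤ) → (∀ k → a k * b k ≡ + 1 mod μ k) → Aut μ
  shearAut a b c ab≡1 = mkAut to from
    (λ (mk≈ x≡ t≡) → mk≈ x≡ (λ k → mod-+ (mod-*ˡ (a k) (t≡ k)) (mod-reflexive (cong (c k *_) x≡))))
    (λ (mk≈ x≡ t≡) → mk≈ x≡ (λ k → mod-*ˡ (b k) (mod-+ (t≡ k) (mod-reflexive (cong (λ x → - (c k * x)) x≡)))))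
    (λ g h → ≈-pointwise μ refl (λ k → distrib (a k) (c k) (proj₂ g k) (proj₂ h k) (proj₁ g) (proj₁ h)))
    (λ g → mk≈ refl (λ k → mod-trans (mod-+ (unit-cancel (a k) (b k) _ (ab≡1 k)) mod-refl)
                                     (mod-reflexive (sub-add (proj₂ g k) (c k * proj₁ g)))))
    (λ g → mk≈ refl (λ k → mod-trans (mod-reflexive (cong (b k *_) (add-sub (a k * proj₂ g k) (c k * proj₁ g))))
                                     (unit-cancel (b k) (a k) _ (mod-trans (mod-reflexive (ℤP.*-comm (b k) (a k))) (ab≡1 k)))))
    where
    to from : G r → G r
    to   (x , t) = x , λ k → a k * t k + c k * x
    from (x , t) = x , λ k → b k * (t k - c k * x)
    distrib : ∀ a c t s x y → a * (t + s) + c * (x + y) ≡ (a * t + c * x) + (a * s + c * y)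
    distrib = solve-∀
    sub-add : ∀ t u → t - u + u ≡ t
    sub-add = solve-∀
    add-sub : ∀ t u → t + u - u ≡ t
    add-sub = solve-∀

  negateAut : Aut μ
  negateAut = mkAut negate negate
    (λ (mk≈ x≡ t≡) → mk≈ (cong -_ x≡) t≡)
    (λ (mk≈ x≡ t≡) → mk≈ (cong -_ x≡) t≡)
    (λ g h → ≈-pointwise μ (ℤP.neg-distrib-+ (proj₁ g) (proj₁ h)) (λ k → refl))
    (λ g → ≈-pointwise μ (ℤP.neg-involutive (proj₁ g)) (λ k → refl))
    (λ g → ≈-pointwise μ (ℤP.neg-involutive (proj₁ g)) (λ k → refl))
    where
    negate : G r → G r
    negate (x , t) = - x , t

  permuteAut : (π : Permutation′ r) → (∀ k → μ (π ⟨$⟩ʳ k) ≡ μ k) → Aut μ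
  permuteAut π μπ≡μ = mkAut to from
    (λ (mk≈ x≡ t≡) → mk≈ x≡ (λ k → subst (λ m → _ ≡ _ mod m) (μπ≡μ k) (t≡ (π ⟨$⟩ʳ k))))
    (λ (mk≈ x≡ t≡) → mk≈ x≡ (λ k → subst (λ m → _ ≡ _ mod m) μπ⁻¹≡μ (t≡ (π ⟨$⟩ˡ k))))
    (λ g h → ≈-refl μ)
    (λ g → ≈-pointwise μ refl (λ k → cong (proj₂ g) (inverseˡ π)))
    (λ g → ≈-pointwise μ refl (λ k → cong (proj₂ g) (inverseʳ π)))
    where
    to from : G r → G r
    to   (x , t) = x , λ k → t (π ⟨$⟩ʳ k)
    from (x , t) = x , λ k → t (π ⟨$⟩ˡ k)
    μπ⁻¹≡μ : ∀ {k} → μ (π ⟨$⟩ˡ k) ≡ μ k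
    μπ⁻¹≡μ {k} = trans (sym (μπ≡μ (π ⟨$⟩ˡ k))) (cong μ (inverseʳ π))

Generates : ∀ {n r} → (Fin r → ℕ) → (Fin (suc n) → G r) → Set
Generates {r = r} μ Q = ∀ i (g : G r) → ∃[ x ] (x i ≡ + 0 × combG x Q ≈[ μ ] g)

-- The Gorenstein condition in class group terms: for every i, D₀ + ⋯ + Dₙ is linearly equivalent
-- to a multiple of Dᵢ, i.e. the anticanonical divisor is Cartier on the chart missing vᵢ.
AnticanonicalMultiple : ∀ {n r} → (Fin r → ℕ) → (Fin (suc n) → G r) → Set
AnticanonicalMultiple μ Q = ∀ i → ∃[ y ] combG ones Q ≈[ μ ] y ·G Q i

record GorensteinPresentation {n r} (μ : Fin r → ℕ) (P : Mat n (suc n)) (Q : Fin (suc n) → G r) : Set where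
  field
    generates     : Generates μ Q
    kernelBasis   : KernelBasis μ Q P
    anticanonical : AnticanonicalMultiple μ Q
open GorensteinPresentation public

presentation-aut : ∀ {n r} {μ : Fin r → ℕ} {P : Mat n (suc n)} {Q : Fin (suc n) → G r} (φ : Aut μ) →
                   GorensteinPresentation μ P Q → GorensteinPresentation μ P (λ i → Aut.to φ (Q i))
presentation-aut {μ = μ} {P} {Q} φ record { generates = gen ; kernelBasis = (rows∈ker , ker⊆rows , independent)
                                           ; anticanonical = anti } = record
  { generates = λ i g → let (x , xᵢ≡0 , Qx≈) = gen i (from g)
                        in x , xᵢ≡0 , ≈-trans μ (≈-sym μ (to-combG x Q)) (≈-trans μ (to-cong Qx≈) (to-from g))
  ; kernelBasis =
      (λ k → ≈⇒Eq μ (≈-trans μ (≈-sym μ (to-combG (P k) Q)) (≈-trans μ (to-cong (Eq⇒≈ μ (rows∈ker k))) to-0)))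
    , (λ x x∈ker → ker⊆rows x (≈⇒Eq μ (to-reflects-0 (≈-trans μ (to-combG x Q) (Eq⇒≈ μ x∈ker)))))
    , independent
  ; anticanonical = λ i → let (y , Σ≈yQᵢ) = anti i
                          in y , ≈-trans μ (≈-sym μ (to-combG ones Q)) (≈-trans μ (to-cong Σ≈yQᵢ) (to-· y (Q i))) }
  where
  open AutProperties φ
  open Aut φ using (from)

anticanonical-relation : ∀ {n r} {μ : Fin r → ℕ} (Q : Fin (suc n) → G r) i y →
                         combG ones Q ≈[ μ ] y ·G Q i → combG (λ j → + 1 - y * e i j) Q ≈[ μ ] 0G
anticanonical-relation {μ = μ} Q i y Σ≈yQi = begin
  combG (λ j → + 1 - y * e i j) Q
    ≈⟨ ≈-pointwise μ (expand (λ j → proj₁ (Q j))) (λ k → expand (λ j → proj₂ (Q j) k)) ⟩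
  combG ones Q +G (-G (y ·G Q i))
    ≈⟨ +G-cong μ Σ≈yQi (≈-refl μ) ⟩
  (y ·G Q i) +G (-G (y ·G Q i))
    ≈⟨ +G-inverseʳ μ (y ·G Q i) ⟩
  0G
    ∎
  where
  open SetoidReasoning (G-setoid μ)
  distrib : ∀ y e q → (+ 1 - y * e) * q ≡ + 1 * q - y * (e * q)
  distrib = solve-∀
  expand : ∀ q → sumᶠ (λ j → (+ 1 - y * e i j) * q j) ≡ sumᶠ (λ j → + 1 * q j) + - (y * q i)
  expand q = trans (sum-cong (λ j → distrib y (e i j) (q j)))
                   (trans (sum-sub (λ j → + 1 * q j) (λ j → y * (e i j * q j)))
                          (cong (λ u → sumᶠ (λ j → + 1 * q j) - u)
                                (trans (sum-*ˡ y (λ j → e i j * q j)) (cong (y *_) (sum-e i q)))))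

anticanonical⇒gorenstein : ∀ {n r} {μ : Fin r → ℕ} {Q : Fin (suc n) → G r} {P′ : Mat n (suc n)} →
                           KernelBasis μ Q P′ → AnticanonicalMultiple μ Q → Gorenstein P′
anticanonical⇒gorenstein {n} {μ = μ} {Q} {P′} (_ , spans , _) anticanonical i = fromMultiple (anticanonical i)
  where
  fromMultiple : ∃[ y ] combG ones Q ≈[ μ ] y ·G Q i → ∃[ u ] (∀ j → ¬ j ≡ i → dot u (col P′ j) ≡ - (+ 1))
  fromMultiple (y , Σ≈yQᵢ) = fromRelation (spans x (≈⇒Eq μ (anticanonical-relation Q i y Σ≈yQᵢ)))
    where
    x : Vz (suc n)
    x j = + 1 - y * e i j
    fromRelation : ∃[ c ] (∀ j → x j ≡ sumᶠ (λ k → c k * P′ k j)) →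
                   ∃[ u ] (∀ j → ¬ j ≡ i → dot u (col P′ j) ≡ - (+ 1))
    fromRelation (c , x≗cP′) = (λ k → - c k) , λ j j≢i → begin
      sumᶠ (λ k → - c k * P′ k j)   ≡⟨ sum-cong (λ k → sym (ℤP.neg-distribˡ-* (c k) (P′ k j))) ⟩
      sumᶠ (λ k → - (c k * P′ k j)) ≡⟨ sum-neg (λ k → c k * P′ k j) ⟩
      - sumᶠ (λ k → c k * P′ k j)   ≡⟨ cong -_ (x≗cP′ j) ⟨
      - (+ 1 - y * e i j)           ≡⟨ cong (λ u → - (+ 1 - y * u)) (e-offdiag i j (λ i≡j → j≢i (sym i≡j))) ⟩
      - (+ 1 - y * + 0)             ≡⟨ cong (λ u → - (+ 1 - u)) (ℤP.*-zeroʳ y) ⟩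
      - (+ 1)                       ∎
      where open ≡-Reasoning

-- The presentation of a Gorenstein fake weighted projective space

cone⇒rows-independent : ∀ {n m} {P : Mat n m} → GeneratesAsCone P →
                        ∀ c → (∀ i → sumᶠ (λ k → c k * P k i) ≡ + 0) → ∀ k → c k ≡ + 0
cone⇒rows-independent {n} {m} {P} cone c cP≡0 k =
  nonzero-factor (+ t) (c k) tc≡0 (λ t≡0 → ℕP.<⇒≢ 1≤t (sym (ℤP.+-injective t≡0)))
  where
  c′ : Fin m → ℕ
  c′ = proj₁ (cone (e k))
  t : ℕ
  t = proj₁ (proj₂ (cone (e k)))
  1≤t : 1 ℕ.≤ t
  1≤t = proj₁ (proj₂ (proj₂ (cone (e k))))
  c′P≡te : ∀ k′ → sumᶠ (λ i → + c′ i * P k′ i) ≡ + t * e k k′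
  c′P≡te = proj₂ (proj₂ (proj₂ (cone (e k))))
  tc≡0 : + t * c k ≡ + 0
  tc≡0 = begin
    + t * c k
      ≡⟨ sum-e k (λ k′ → + t * c k′) ⟨
    sumᶠ (λ k′ → e k k′ * (+ t * c k′))
      ≡⟨ sum-cong (λ k′ → swap (e k k′) (+ t) (c k′)) ⟩
    sumᶠ (λ k′ → c k′ * (+ t * e k k′))
      ≡⟨ sum-cong (λ k′ → cong (c k′ *_) (c′P≡te k′)) ⟨
    sumᶠ (λ k′ → c k′ * sumᶠ (λ i → + c′ i * P k′ i))
      ≡⟨ dot-combination c (λ i → + c′ i) (λ i k′ → P k′ i) ⟩
    sumᶠ (λ i → + c′ i * sumᶠ (λ k′ → c k′ * P k′ i))
      ≡⟨ sum-zero _ (λ i → trans (cong (+ c′ i *_) (cP≡0 i)) (ℤP.*-zeroʳ (+ c′ i))) ⟩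
    + 0
      ∎
    where
    open ≡-Reasoning
    swap : ∀ d t c → d * (t * c) ≡ c * (t * d)
    swap = solve-∀

cone⇒positiveRelation : ∀ {n m} {P : Mat n m} → GeneratesAsCone P →
                        ∃[ λ′ ] ((∀ i → + 1 ℤ.≤ λ′ i) × (∀ k → dot λ′ (P k) ≡ + 0))
cone⇒positiveRelation {n} {m} {P} cone = λ′ , λ′≥1 , λ′P≡0
  where
  u : Vz n
  u k = - sumᶠ (P k)
  c′ : Fin m → ℕ
  c′ = proj₁ (cone u)
  t : ℕ
  t = proj₁ (proj₂ (cone u))
  1≤t : 1 ℕ.≤ t
  1≤t = proj₁ (proj₂ (proj₂ (cone u)))
  c′P≡tu : ∀ k → sumᶠ (λ i → + c′ i * P k i) ≡ + t * u k
  c′P≡tu = proj₂ (proj₂ (proj₂ (cone u)))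
  λ′ : Vz m
  λ′ i = + c′ i + + t
  λ′≥1 : ∀ i → + 1 ℤ.≤ λ′ i
  λ′≥1 i = ℤ.+≤+ (ℕP.≤-trans 1≤t (ℕP.m≤n+m t (c′ i)))
  λ′P≡0 : ∀ k → dot λ′ (P k) ≡ + 0
  λ′P≡0 k = begin
    sumᶠ (λ i → (+ c′ i + + t) * P k i)
      ≡⟨ sum-cong (λ i → ℤP.*-distribʳ-+ (P k i) (+ c′ i) (+ t)) ⟩
    sumᶠ (λ i → + c′ i * P k i + + t * P k i)
      ≡⟨ sum-+ (λ i → + c′ i * P k i) (λ i → + t * P k i) ⟩
    sumᶠ (λ i → + c′ i * P k i) + sumᶠ (λ i → + t * P k i)
      ≡⟨ cong₂ _+_ (c′P≡tu k) (sum-*ˡ (+ t) (P k)) ⟩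
    + t * (- sumᶠ (P k)) + + t * sumᶠ (P k)
      ≡⟨ cancel (+ t) (sumᶠ (P k)) ⟩
    + 0
      ∎
    where
    open ≡-Reasoning
    cancel : ∀ t s → t * (- s) + t * s ≡ + 0
    cancel = solve-∀

positive-factor : ∀ q m → + 1 ℤ.≤ q * + suc m → + 1 ℤ.≤ q
positive-factor (+ zero)    m (ℤ.+≤+ ())
positive-factor ℤ.+[1+ a ]  m _ = ℤ.+≤+ (ℕ.s≤s ℕ.z≤n)
positive-factor ℤ.-[1+ a ]  m ()

negative-factor : ∀ q m → + 1 ℤ.≤ q * ℤ.-[1+ m ] → + 1 ℤ.≤ - q
negative-factor (+ zero)    m (ℤ.+≤+ ())
negative-factor ℤ.+[1+ a ]  m ()
negative-factor ℤ.-[1+ a ]  m _ = ℤ.+≤+ (ℕ.s≤s ℕ.z≤n)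

proportional⇒sameSign : ∀ {n} (λ′ q : Vz (suc n)) m → (∀ i → + 1 ℤ.≤ λ′ i) → (∀ i → λ′ i ≡ q i * m) →
                        (∀ i → + 1 ℤ.≤ q i) ⊎ (∀ i → + 1 ℤ.≤ - q i)
proportional⇒sameSign λ′ q (+ zero) λ′≥1 λ′≡qm
  with subst (+ 1 ℤ.≤_) (trans (λ′≡qm zero) (ℤP.*-zeroʳ (q zero))) (λ′≥1 zero)
... | ℤ.+≤+ ()
proportional⇒sameSign λ′ q ℤ.+[1+ m ] λ′≥1 λ′≡qm =
  inj₁ (λ i → positive-factor (q i) m (subst (+ 1 ℤ.≤_) (λ′≡qm i) (λ′≥1 i)))
proportional⇒sameSign λ′ q ℤ.-[1+ m ] λ′≥1 λ′≡qm =
  inj₂ (λ i → negative-factor (q i) m (subst (+ 1 ℤ.≤_) (λ′≡qm i) (λ′≥1 i)))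

∣g∣≡1⇒g*g≡1 : ∀ g → ℤ.∣ g ∣ ≡ 1 → g * g ≡ + 1
∣g∣≡1⇒g*g≡1 (+ 1)        refl = refl
∣g∣≡1⇒g*g≡1 ℤ.-[1+ 0 ]   refl = refl

primitive⇒unimodular : ∀ {m} (v : Vz (suc m)) → Primitive v → ∃[ c ] dot c v ≡ + 1
primitive⇒unimodular {m} v v-primitive = unimodular (rowReduce m v)
  where
  unimodular : ∃[ A ] ∃[ g ] (∀ y → dot v (apply (U A) y) ≡ g * y zero) → ∃[ c ] dot c v ≡ + 1
  unimodular (A , g , reduced) = apply (U A) y , trans (dot-comm (apply (U A) y) v) (trans (reduced y) g*g≡1)
    where
    y : Vz (suc m)
    y j = g * e zero j
    v≡g* : ∀ k → v k ≡ g * apply (U⁻¹ A) (e k) zero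
    v≡g* k = begin
      v k
        ≡⟨ sum-eʳ k v ⟨
      sumᶠ (λ j → v j * e j k)
        ≡⟨ sum-cong (λ j → cong (v j *_) (trans (e-sym j k) (sym (U-U⁻¹ A (e k) j)))) ⟩
      dot v (apply (U A) (apply (U⁻¹ A) (e k)))
        ≡⟨ reduced (apply (U⁻¹ A) (e k)) ⟩
      g * apply (U⁻¹ A) (e k) zero
        ∎
      where open ≡-Reasoning
    ∣g∣≡1 : ℤ.∣ g ∣ ≡ 1
    ∣g∣≡1 = v-primitive ℤ.∣ g ∣ (λ k → ℕD.divides ℤ.∣ apply (U⁻¹ A) (e k) zero ∣
                                   (trans (cong ℤ.∣_∣ (v≡g* k)) (trans (ℤP.abs-* g _) (ℕP.*-comm ℤ.∣ g ∣ _))))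
    g*g≡1 : g * y zero ≡ + 1
    g*g≡1 = trans (cong (g *_) (ℤP.*-identityʳ g)) (∣g∣≡1⇒g*g≡1 g ∣g∣≡1)

module FromFWPS {n : ℕ} {P : Mat (suc n) (suc (suc n))} (fwps : IsFWPS P) (gor : Gorenstein P)
                {r : ℕ} {μ : Fin r → ℕ} (μ≥1 : ∀ k → 1 ℕ.≤ μ k) (cl : ClassGroupIso P μ) where

  rowCombination : Vz (suc n) → Vz (suc (suc n))
  rowCombination c i = sumᶠ (λ k → c k * P k i)

  Q₀ : Fin (suc (suc n)) → G r
  Q₀ = proj₁ cl

  surjective : ∀ g → ∃[ x ] Eq μ (combG x Q₀) g
  surjective = proj₁ (proj₂ cl)

  kernel⊆image : ∀ x → Eq μ (combG x Q₀) 0G → ∃[ c ] (∀ i → x i ≡ rowCombination c i)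
  kernel⊆image = proj₁ (proj₂ (proj₂ cl))

  image⊆kernel : ∀ c → Eq μ (combG (rowCombination c) Q₀) 0G
  image⊆kernel = proj₂ (proj₂ (proj₂ cl))

  q : Vz (suc (suc n))
  q i = proj₁ (Q₀ i)

  λ′ : Vz (suc (suc n))
  λ′ = proj₁ (cone⇒positiveRelation {P = P} (proj₂ (proj₂ fwps)))

  λ′≥1 : ∀ i → + 1 ℤ.≤ λ′ i
  λ′≥1 = proj₁ (proj₂ (cone⇒positiveRelation {P = P} (proj₂ (proj₂ fwps))))

  λ′P≡0 : ∀ k → dot λ′ (P k) ≡ + 0
  λ′P≡0 = proj₂ (proj₂ (cone⇒positiveRelation {P = P} (proj₂ (proj₂ fwps))))

  relation-kills-kernel : ∀ x → combG x Q₀ ≈[ μ ] 0G → dot λ′ x ≡ + 0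
  relation-kills-kernel x x∈ker with kernel⊆image x (≈⇒Eq μ x∈ker)
  ... | c , x≗cP = trans (dot-congʳ λ′ x≗cP)
                         (trans (dot-combination λ′ c P)
                                (sum-zero _ (λ k → trans (cong (c k *_) (λ′P≡0 k)) (ℤP.*-zeroʳ (c k)))))

  M : ℕ
  M = product (tabulate μ)

  μ∣M : ∀ k → + μ k S.∣ + M
  μ∣M k = S.∣ᵤ⇒∣ (∈⇒∣product (∈-tabulate⁺ k))

  M≢0 : ¬ + M ≡ + 0
  M≢0 = ℕ.≢-nonZero⁻¹ M {{product≢0 (tabulate⁺ (λ k → ℕ.>-nonZero (μ≥1 k)))}} ∘ ℤP.+-injective

  x₁ : Vz (suc (suc n))
  x₁ = proj₁ (surjective (+ 1 , λ _ → + 0))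
  qx₁≡1 : sumᶠ (λ j → x₁ j * q j) ≡ + 1
  qx₁≡1 = proj₁ (proj₂ (surjective (+ 1 , λ _ → + 0)))

  -- M (e i - q i x₁) lies in the kernel since M kills the torsion.
  relation-proportional : ∀ i → λ′ i ≡ q i * dot λ′ x₁
  relation-proportional i = ℤP.i-j≡0⇒i≡j _ _ (nonzero-factor (+ M) _ M[λᵢ-qᵢm]≡0 M≢0)
    where
    y : Vz (suc (suc n))
    y j = + M * (e i j - q i * x₁ j)
    ysum : ∀ F → sumᶠ (λ j → y j * F j) ≡ + M * (F i - q i * sumᶠ (λ j → x₁ j * F j))
    ysum F = begin
      sumᶠ (λ j → y j * F j)
        ≡⟨ sum-cong (λ j → distrib (+ M) (e i j) (q i) (x₁ j) (F j)) ⟩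
      sumᶠ (λ j → + M * (e i j * F j - q i * (x₁ j * F j)))
        ≡⟨ sum-*ˡ (+ M) (λ j → e i j * F j - q i * (x₁ j * F j)) ⟩
      + M * sumᶠ (λ j → e i j * F j - q i * (x₁ j * F j))
        ≡⟨ cong (+ M *_) (sum-sub (λ j → e i j * F j) (λ j → q i * (x₁ j * F j))) ⟩
      + M * (sumᶠ (λ j → e i j * F j) - sumᶠ (λ j → q i * (x₁ j * F j)))
        ≡⟨ cong₂ (λ a b → + M * (a - b)) (sum-e i F) (sum-*ˡ (q i) (λ j → x₁ j * F j)) ⟩
      + M * (F i - q i * sumᶠ (λ j → x₁ j * F j))
        ∎
      where
      open ≡-Reasoning
      distrib : ∀ M e qi x f → M * (e - qi * x) * f ≡ M * (e * f - qi * (x * f))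
      distrib = solve-∀
    y∈ker : combG y Q₀ ≈[ μ ] 0G
    y∈ker = mk≈ (trans (ysum q) (trans (cong (λ u → + M * (q i - q i * u)) qx₁≡1) (vanish (+ M) (q i))))
                (λ k → mod-trans (mod-reflexive (ysum (λ j → proj₂ (Q₀ j) k)))
                                 (divisible⇒≡0 (S.∣m⇒∣m*n _ (μ∣M k))))
      where
      vanish : ∀ M a → M * (a - a * + 1) ≡ + 0
      vanish = solve-∀
    M[λᵢ-qᵢm]≡0 : + M * (λ′ i - q i * dot λ′ x₁) ≡ + 0
    M[λᵢ-qᵢm]≡0 = begin
      + M * (λ′ i - q i * dot λ′ x₁)                 ≡⟨ cong (λ u → + M * (λ′ i - q i * u)) (dot-comm λ′ x₁) ⟩
      + M * (λ′ i - q i * sumᶠ (λ j → x₁ j * λ′ j))   ≡⟨ ysum λ′ ⟨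
      sumᶠ (λ j → y j * λ′ j)                        ≡⟨ dot-comm y λ′ ⟩
      dot λ′ y                                       ≡⟨ relation-kills-kernel y y∈ker ⟩
      + 0                                            ∎
      where open ≡-Reasoning

  rowCombination∈kernel : ∀ c → combG (rowCombination c) Q₀ ≈[ μ ] 0G
  rowCombination∈kernel c = Eq⇒≈ μ {combG (rowCombination c) Q₀} {0G} (image⊆kernel c)

  generates₀ : Generates μ Q₀
  generates₀ i g = avoid (surjective g) (primitive⇒unimodular (col P i) (proj₁ fwps i))
    where
    avoid : ∃[ x ] Eq μ (combG x Q₀) g → ∃[ c ] dot c (col P i) ≡ + 1 →
            ∃[ x ] (x i ≡ + 0 × combG x Q₀ ≈[ μ ] g)
    avoid (x₀ , Qx₀≡g) (c , zᵢ≡1) = x , xᵢ≡0 , combG-x≈g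
      where
      open SetoidReasoning (G-setoid μ)
      z x : Vz (suc (suc n))
      z = rowCombination c
      x j = x₀ j + - x₀ i * z j
      cancel : ∀ a → a + - a * + 1 ≡ + 0
      cancel = solve-∀
      xᵢ≡0 : x i ≡ + 0
      xᵢ≡0 = trans (cong (λ u → x₀ i + - x₀ i * u) zᵢ≡1) (cancel (x₀ i))
      combG-x≈g : combG x Q₀ ≈[ μ ] g
      combG-x≈g = begin
        combG x Q₀                                   ≈⟨ combG-+ μ x₀ (λ j → - x₀ i * z j) Q₀ ⟩
        combG x₀ Q₀ +G combG (λ j → - x₀ i * z j) Q₀ ≈⟨ +G-cong μ (Eq⇒≈ μ {combG x₀ Q₀} {g} Qx₀≡g)
                                                                   (combG-· μ (- x₀ i) z Q₀) ⟩
        g +G (- x₀ i ·G combG z Q₀)                  ≈⟨ +G-cong μ (≈-refl μ {g})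
                                                                   (·G-cong μ (- x₀ i) (rowCombination∈kernel c)) ⟩
        g +G (- x₀ i ·G 0G)                          ≈⟨ +G-cong μ (≈-refl μ {g}) (·G-zeroʳ μ (- x₀ i)) ⟩
        g +G 0G                                      ≈⟨ +G-identityʳ μ g ⟩
        g                                            ∎

  anticanonical₀ : AnticanonicalMultiple μ Q₀
  anticanonical₀ i = y i , (begin
    combG ones Q₀
      ≈⟨ +G-identityʳ μ (combG ones Q₀) ⟨
    combG ones Q₀ +G 0G
      ≈⟨ +G-cong μ (≈-refl μ {combG ones Q₀}) (rowCombination∈kernel u) ⟨
    combG ones Q₀ +G combG z Q₀
      ≈⟨ combG-+ μ ones z Q₀ ⟨
    combG y Q₀
      ≈⟨ combG-supported μ i y Q₀ (λ j j≢i → cong (_+_ (+ 1)) (proj₂ (gor i) j j≢i)) ⟩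
    y i ·G Q₀ i
      ∎)
    where
    open SetoidReasoning (G-setoid μ)
    u : Vz (suc n)
    u = proj₁ (gor i)
    z y : Vz (suc (suc n))
    z = rowCombination u
    y j = + 1 + z j

  kernelBasis₀ : KernelBasis μ Q₀ P
  kernelBasis₀ =
      (λ k → ≈⇒Eq μ (≈-trans μ (combG-cong μ Q₀ (λ i → sym (sum-e k (λ k′ → P k′ i))))
                               (rowCombination∈kernel (e k))))
    , kernel⊆image
    , cone⇒rows-independent {P = P} (proj₂ (proj₂ fwps))

  presentation : GorensteinPresentation μ P Q₀
  presentation = record { generates = generates₀ ; kernelBasis = kernelBasis₀ ; anticanonical = anticanonical₀ }

  weights-sameSign : (∀ i → + 1 ℤ.≤ q i) ⊎ (∀ i → + 1 ℤ.≤ - q i)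
  weights-sameSign = proportional⇒sameSign λ′ q (dot λ′ x₁) λ′≥1 relation-proportional

fwps⇒positivePresentation : ∀ {n} {P : Mat (suc n) (suc (suc n))} → IsFWPS P → Gorenstein P →
                            ∀ {r} {μ : Fin r → ℕ} → (∀ k → 1 ℕ.≤ μ k) → ClassGroupIso P μ →
                            ∃[ Q ] (GorensteinPresentation μ P Q × (∀ i → + 1 ℤ.≤ weightRow Q i))
fwps⇒positivePresentation {P = P} fwps gor {μ = μ} μ≥1 cl = bySign weights-sameSign
  where
  open FromFWPS fwps gor μ≥1 cl
  bySign : (∀ i → + 1 ℤ.≤ q i) ⊎ (∀ i → + 1 ℤ.≤ - q i) →
           ∃[ Q ] (GorensteinPresentation μ P Q × (∀ i → + 1 ℤ.≤ weightRow Q i))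
  bySign (inj₁ q≥1)  = Q₀ , presentation , q≥1
  bySign (inj₂ -q≥1) = (λ i → Aut.to (negateAut {μ = μ}) (Q₀ i)) , presentation-aut negateAut presentation , -q≥1

-- Minimal torsion vectors

Vn : ℕ → Set
Vn = Vector ℕ

module _ {m : ℕ} where

  lex-cong : ∀ {a a′ b b′ : Vn m} → (∀ i → a i ≡ a′ i) → (∀ i → b i ≡ b′ i) →
             LexLt a b → LexLt a′ b′
  lex-cong a≗a′ b≗b′ (i , aᵢ<bᵢ , prefix) =
    i , subst₂ ℕ._<_ (a≗a′ i) (b≗b′ i) aᵢ<bᵢ ,
    λ j j<i → trans (sym (a≗a′ j)) (trans (prefix j j<i) (b≗b′ j))

  lexLe-cong : ∀ {a a′ b b′ : Vn m} → (∀ i → a i ≡ a′ i) → (∀ i → b i ≡ b′ i) →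
               LexLe a b → LexLe a′ b′
  lexLe-cong a≗a′ b≗b′ (inj₁ a<b) = inj₁ (lex-cong a≗a′ b≗b′ a<b)
  lexLe-cong a≗a′ b≗b′ (inj₂ a≗b) = inj₂ (λ i → trans (sym (a≗a′ i)) (trans (a≗b i) (b≗b′ i)))

  lexLe-refl : ∀ {a : Vn m} → LexLe a a
  lexLe-refl = inj₂ (λ i → refl)

lex-trans : ∀ {m} {a b c : Vn m} → LexLt a b → LexLt b c → LexLt a c
lex-trans (i , aᵢ<bᵢ , a≡b) (j , bⱼ<cⱼ , b≡c) with ℕP.<-cmp (Fin.toℕ i) (Fin.toℕ j)
... | tri< i<j _ _ =
      i , subst (_ ℕ.<_) (b≡c i i<j) aᵢ<bᵢ , λ k k<i → trans (a≡b k k<i) (b≡c k (ℕP.<-trans k<i i<j))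
... | tri≈ _ i≡j _ rewrite FinP.toℕ-injective i≡j =
      j , ℕP.<-trans aᵢ<bᵢ bⱼ<cⱼ , λ k k<j → trans (a≡b k k<j) (b≡c k k<j)
... | tri> _ _ j<i =
      j , subst (ℕ._< _) (sym (a≡b j j<i)) bⱼ<cⱼ , λ k k<j → trans (a≡b k (ℕP.<-trans k<j j<i)) (b≡c k k<j)

lexLe-trans : ∀ {m} {a b c : Vn m} → LexLe a b → LexLe b c → LexLe a c
lexLe-trans (inj₁ a<b) (inj₁ b<c) = inj₁ (lex-trans a<b b<c)
lexLe-trans (inj₁ a<b) (inj₂ b≗c) = inj₁ (lex-cong (λ i → refl) b≗c a<b)
lexLe-trans (inj₂ a≗b) (inj₁ b<c) = inj₁ (lex-cong (λ i → sym (a≗b i)) (λ i → refl) b<c)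
lexLe-trans (inj₂ a≗b) (inj₂ b≗c) = inj₂ (λ i → trans (a≗b i) (b≗c i))

lexLe-≢⇒lex : ∀ {m} {a b : Vn m} → LexLe a b → ¬ (∀ i → a i ≡ b i) → LexLt a b
lexLe-≢⇒lex (inj₁ a<b) _   = a<b
lexLe-≢⇒lex (inj₂ a≗b) a≢b = ⊥-elim (a≢b a≗b)

lexLe-or-gt : ∀ {m} (a b : Vn m) → LexLe a b ⊎ LexLt b a
lexLe-or-gt {zero}  a b = inj₁ (inj₂ (λ ()))
lexLe-or-gt {suc m} a b with ℕP.<-cmp (a zero) (b zero)
... | tri< a₀<b₀ _ _ = inj₁ (inj₁ (zero , a₀<b₀ , λ j ()))
... | tri> _ _ b₀<a₀ = inj₂ (zero , b₀<a₀ , λ j ())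
... | tri≈ _ a₀≡b₀ _ with lexLe-or-gt (λ i → a (suc i)) (λ i → b (suc i))
...   | inj₁ (inj₁ (i , lt , prefix)) =
        inj₁ (inj₁ (suc i , lt , λ { zero _ → a₀≡b₀ ; (suc j) (ℕ.s≤s j<i) → prefix j j<i }))
...   | inj₁ (inj₂ a≗b) =
        inj₁ (inj₂ (λ { zero → a₀≡b₀ ; (suc i) → a≗b i }))
...   | inj₂ (i , lt , prefix) =
        inj₂ (suc i , lt , λ { zero _ → sym a₀≡b₀ ; (suc j) (ℕ.s≤s j<i) → prefix j j<i })

lexMinimum : ∀ {N m} {D : Fin N → Set} → Decidable D → (F : Fin N → Vn m) → ∃ D →
             ∃[ l ] (D l × (∀ l′ → D l′ → LexLe (F l) (F l′)))
lexMinimum {suc N} {D = D} D? F (l₀ , dl₀) with FinP.any? (λ l → D? (suc l))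
... | no none with l₀
...   | zero   = zero , dl₀ , λ { zero _ → lexLe-refl ; (suc l′) dl′ → ⊥-elim (none (l′ , dl′)) }
...   | suc l₁ = ⊥-elim (none (l₁ , dl₀))
lexMinimum {suc N} {D = D} D? F (l₀ , dl₀) | yes witness
  with lexMinimum (λ l → D? (suc l)) (λ l → F (suc l)) witness | D? zero
... | l , dl , minimal | no ¬d₀ = suc l , dl , λ { zero d₀ → ⊥-elim (¬d₀ d₀) ; (suc l′) dl′ → minimal l′ dl′ }
... | l , dl , minimal | yes d₀ with lexLe-or-gt (F zero) (F (suc l))
...   | inj₁ F₀≤ = zero , d₀ , λ { zero _ → lexLe-refl ; (suc l′) dl′ → lexLe-trans F₀≤ (minimal l′ dl′) }
...   | inj₂ F₀> = suc l , dl , λ { zero _ → inj₁ F₀> ; (suc l′) dl′ → minimal l′ dl′ }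

module AffineAut {m : ℕ} (φ : Aut (oneTorsion (suc m))) where

  private
    μ : ℕ
    μ = suc m
    μ₁ : Fin 1 → ℕ
    μ₁ = oneTorsion μ

  open AutProperties φ
  open Aut φ using (to; from)

  e₁ e₂ : G 1
  e₁ = + 1 , λ _ → + 0
  e₂ = + 0 , λ _ → + 1

  s c a : ℤ
  s = proj₁ (to e₁)
  c = proj₂ (to e₁) zero
  a = proj₂ (to e₂) zero

  to-pair : ∀ x y → to (x , λ _ → y) ≈[ μ₁ ] (x ·G to e₁) +G (y ·G to e₂)
  to-pair x y = begin
    to (x , λ _ → y)                 ≈⟨ to-cong (≈-pointwise μ₁ (split₁ x y) (λ _ → split₂ x y)) ⟩
    to ((x ·G e₁) +G (y ·G e₂))      ≈⟨ to-+ (x ·G e₁) (y ·G e₂) ⟩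
    to (x ·G e₁) +G to (y ·G e₂)     ≈⟨ +G-cong μ₁ (to-· x e₁) (to-· y e₂) ⟩
    (x ·G to e₁) +G (y ·G to e₂)     ∎
    where
    open SetoidReasoning (G-setoid μ₁)
    split₁ : ∀ x y → x ≡ x * + 1 + y * + 0
    split₁ = solve-∀
    split₂ : ∀ x y → y ≡ x * + 0 + y * + 1
    split₂ = solve-∀

  -- e₂ has order μ, so its image has weight 0.
  to-e₂-weight : proj₁ (to e₂) ≡ + 0
  to-e₂-weight = nonzero-factor (+ μ) _ (weight-≡ (begin
    + μ ·G to e₂    ≈⟨ to-· (+ μ) e₂ ⟨
    to (+ μ ·G e₂)  ≈⟨ to-cong (mk≈ (ℤP.*-zeroʳ (+ μ)) (λ _ → multiple≡0 (+ 1))) ⟩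
    to 0G           ≈⟨ to-0 ⟩
    0G              ∎)) λ ()
    where open SetoidReasoning (G-setoid μ₁)

  to-pair-weight : ∀ x y → proj₁ (to (x , λ _ → y)) ≡ x * s
  to-pair-weight x y = trans (weight-≡ (to-pair x y))
                             (trans (cong (λ u → x * s + y * u) to-e₂-weight)
                                    (trans (cong (_+_ (x * s)) (ℤP.*-zeroʳ y)) (ℤP.+-identityʳ _)))

  to-pair-torsion : ∀ x y → proj₂ (to (x , λ _ → y)) zero ≡ a * y + c * x mod μ
  to-pair-torsion x y = mod-trans (torsion-≡ (to-pair x y) zero) (mod-reflexive (commute x c y a))
    where
    commute : ∀ x c y a → x * c + y * a ≡ a * y + c * x
    commute = solve-∀

  fixes-weight⇒s≡1 : ∀ w t → ¬ w ≡ + 0 → proj₁ (to (w , λ _ → t)) ≡ w → s ≡ + 1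
  fixes-weight⇒s≡1 w t w≢0 weight-fixed =
    sym (ℤP.*-cancelˡ-≡ w (+ 1) s {{ℤ.≢-nonZero w≢0}}
                        (trans (ℤP.*-identityʳ w) (trans (sym weight-fixed) (to-pair-weight w t))))

  a-unit : s ≡ + 1 → a * proj₂ (from e₂) zero ≡ + 1 mod μ
  a-unit s≡1 = begin
    a * b                           ≡⟨ ℤP.+-identityʳ (a * b) ⟨
    a * b + + 0                     ≡⟨ cong (λ u → a * b + u) (trans (cong (c *_) F₁≡0) (ℤP.*-zeroʳ c)) ⟨
    a * b + c * F₁                  ≈⟨ to-pair-torsion F₁ b ⟨
    proj₂ (to (F₁ , λ _ → b)) zero  ≈⟨ torsion-≡ to-F≈e₂ zero ⟩
    + 1                             ∎
    where
    open ModReasoning μ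
    b F₁ : ℤ
    b = proj₂ (from e₂) zero
    F₁ = proj₁ (from e₂)
    to-F≈e₂ : to (F₁ , λ _ → b) ≈[ μ₁ ] e₂
    to-F≈e₂ = ≈-trans μ₁ (to-cong (≈-pointwise μ₁ refl (λ { zero → refl }))) (to-from e₂)
    F₁≡0 : F₁ ≡ + 0
    F₁≡0 = trans (sym (trans (to-pair-weight F₁ b) (trans (cong (F₁ *_) s≡1) (ℤP.*-identityʳ F₁))))
                 (weight-≡ to-F≈e₂)

equivalent⇒affine : ∀ {m n} (w η ζ : Vz (suc n)) → ¬ w zero ≡ + 0 → EquivTorsion w (suc m) η ζ →
                    ∃[ a ] ∃[ c ] ∃[ b ] (a * b ≡ + 1 mod suc m × (∀ i → ζ i ≡ a * η i + c * w i mod suc m))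
equivalent⇒affine {m} w η ζ w₀≢0 (φ , φ-maps) = a , c , proj₂ (from e₂) zero , a-unit s≡1 , ζ≡
  where
  open AffineAut φ
  open Aut φ using (to; from)
  maps : ∀ i → to (w i , λ _ → η i) ≈[ oneTorsion (suc m) ] (w i , λ _ → ζ i)
  maps i = Eq⇒≈ (oneTorsion (suc m)) (φ-maps i)
  s≡1 : s ≡ + 1
  s≡1 = fixes-weight⇒s≡1 (w zero) (η zero) w₀≢0 (weight-≡ (maps zero))
  ζ≡ : ∀ i → ζ i ≡ a * η i + c * w i mod suc m
  ζ≡ i = mod-trans (mod-sym (torsion-≡ (maps i) zero)) (to-pair-torsion (w i) (η i))

_≡?_mod_ : ∀ x y m → Dec (x ≡ y mod m)
x ≡? y mod m = Dec.map′ mod-intro divides-difference (+ m S.∣? (x - y))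

module MinimalRow (m : ℕ) {n : ℕ} (w η : Vz (suc n)) where

  private
    μ : ℕ
    μ = suc m

  residue : ℤ → Fin μ
  residue x = Fin.fromℕ< (rep-< m x)

  residue-≡ : ∀ x → x ≡ + Fin.toℕ (residue x) mod μ
  residue-≡ x = mod-trans (rep-≡ m x) (mod-reflexive (cong +_ (sym (FinP.toℕ-fromℕ< (rep-< m x)))))

  shifted : Fin μ → Fin μ → Vz (suc n)
  shifted a c i = + Fin.toℕ a * η i + + Fin.toℕ c * w i

  candidate : Fin μ → Fin μ → Vn (suc n)
  candidate a c = reps μ (shifted a c)

  IsUnit : Fin μ → Set
  IsUnit a = Σ (Fin μ) λ b → + Fin.toℕ a * + Fin.toℕ b ≡ + 1 mod μ

  bestShift : Fin μ → Fin μ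
  bestShift a = proj₁ (lexMinimum {D = λ _ → ⊤} (λ _ → yes tt) (candidate a) (zero , tt))

  bestShift-minimal : ∀ a c → LexLe (candidate a (bestShift a)) (candidate a c)
  bestShift-minimal a c = proj₂ (proj₂ (lexMinimum {D = λ _ → ⊤} (λ _ → yes tt) (candidate a) (zero , tt))) c tt

  module Best (2≤μ : 2 ℕ.≤ μ) (w₀≢0 : ¬ w zero ≡ + 0) where

    best : ∃[ a ] (IsUnit a × (∀ a′ → IsUnit a′ → LexLe (candidate a (bestShift a)) (candidate a′ (bestShift a′))))
    best = lexMinimum {D = IsUnit} (λ a → FinP.any? (λ b → (+ Fin.toℕ a * + Fin.toℕ b) ≡? + 1 mod μ))
                      (λ a → candidate a (bestShift a))
                      (Fin.fromℕ< 2≤μ , Fin.fromℕ< 2≤μ , mod-reflexive one·one≡1)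
      where
      one·one≡1 : + Fin.toℕ (Fin.fromℕ< 2≤μ) * + Fin.toℕ (Fin.fromℕ< 2≤μ) ≡ + 1
      one·one≡1 = cong (λ k → + k * + k) (FinP.toℕ-fromℕ< 2≤μ)

    a* c* : Fin μ
    a* = proj₁ best
    c* = bestShift a*

    a*-unit : IsUnit a*
    a*-unit = proj₁ (proj₂ best)

    minimal : MinimalTorsion w μ (shifted a* c*)
    minimal ζ equivalent = fromAffine (equivalent⇒affine w (shifted a* c*) ζ w₀≢0 equivalent) a*-unit
      where
      fromAffine : (∃[ a′ ] ∃[ c′ ] ∃[ b′ ] (a′ * b′ ≡ + 1 mod μ ×
                                             (∀ i → ζ i ≡ a′ * shifted a* c* i + c′ * w i mod μ))) →
                   IsUnit a* → LexLe (reps μ (shifted a* c*)) (reps μ ζ)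
      fromAffine (a′ , c′ , b′ , a′b′≡1 , ζ≡) (b* , a*b*≡1) =
        lexLe-cong (λ i → refl) (λ i → sym (rep-cong m (ζ≡AC i)))
                   (lexLe-trans (proj₂ (proj₂ best) A A-unit) (bestShift-minimal A C))
        where
        open ModReasoning μ
        A C B : Fin μ
        A = residue (a′ * + Fin.toℕ a*)
        C = residue (a′ * + Fin.toℕ c* + c′)
        B = residue (b′ * + Fin.toℕ b*)
        regroup : ∀ a′ a η c w c′ → a′ * (a * η + c * w) + c′ * w ≡ a′ * a * η + (a′ * c + c′) * w
        regroup = solve-∀
        ζ≡AC : ∀ i → ζ i ≡ shifted A C i mod μ
        ζ≡AC i = begin
          ζ i
            ≈⟨ ζ≡ i ⟩
          a′ * shifted a* c* i + c′ * w i
            ≡⟨ regroup a′ _ (η i) _ (w i) c′ ⟩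
          a′ * + Fin.toℕ a* * η i + (a′ * + Fin.toℕ c* + c′) * w i
            ≈⟨ mod-+ (mod-* (residue-≡ (a′ * + Fin.toℕ a*)) mod-refl)
                     (mod-* (residue-≡ (a′ * + Fin.toℕ c* + c′)) mod-refl) ⟩
          shifted A C i
            ∎
        interchange : ∀ a′ a b′ b → a′ * a * (b′ * b) ≡ a′ * b′ * (a * b)
        interchange = solve-∀
        A-unit : IsUnit A
        A-unit = B , (begin
          + Fin.toℕ A * + Fin.toℕ B
            ≈⟨ mod-* (residue-≡ (a′ * + Fin.toℕ a*)) (residue-≡ (b′ * + Fin.toℕ b*)) ⟨
          a′ * + Fin.toℕ a* * (b′ * + Fin.toℕ b*)
            ≡⟨ interchange a′ (+ Fin.toℕ a*) b′ (+ Fin.toℕ b*) ⟩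
          a′ * b′ * (+ Fin.toℕ a* * + Fin.toℕ b*)
            ≈⟨ mod-* a′b′≡1 a*b*≡1 ⟩
          + 1
            ∎)

record MinimalShear (μ : ℕ) {n} (w η : Vz (suc n)) : Set where
  field
    a b c   : ℤ
    ab≡1    : a * b ≡ + 1 mod μ
    minimal : MinimalTorsion w μ (λ i → a * η i + c * w i)

minimalShear : ∀ μ → 2 ℕ.≤ μ → ∀ {n} (w η : Vz (suc n)) → ¬ w zero ≡ + 0 → MinimalShear μ w η
minimalShear (suc m) 2≤μ w η w₀≢0 = record
  { a = + Fin.toℕ a* ; b = + Fin.toℕ (proj₁ a*-unit) ; c = + Fin.toℕ c*
  ; ab≡1 = proj₂ a*-unit ; minimal = minimal }
  where
  open MinimalRow.Best m w η 2≤μ w₀≢0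

-- Sorting rows of equal order

module _ {r : ℕ} (i j : Fin r) where

  transpose-cases : ∀ k → (k ≡ i × transpose i j ⟨$⟩ʳ k ≡ j)
                        ⊎ (k ≡ j × transpose i j ⟨$⟩ʳ k ≡ i)
                        ⊎ (¬ k ≡ i × ¬ k ≡ j × transpose i j ⟨$⟩ʳ k ≡ k)
  transpose-cases k with k Fin.≟ i
  ... | yes k≡i = inj₁ (k≡i , refl)
  ... | no  k≢i with k Fin.≟ j
  ...   | yes k≡j = inj₂ (inj₁ (k≡j , refl))
  ...   | no  k≢j = inj₂ (inj₂ (k≢i , k≢j , refl))

  transpose-preserves : ∀ (P : Fin r → Set) → P i → P j → ∀ k → P k → P (transpose i j ⟨$⟩ʳ k)
  transpose-preserves P Pi Pj k Pk with transpose-cases k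
  ... | inj₁ (_ , τk≡j)             = subst P (sym τk≡j) Pj
  ... | inj₂ (inj₁ (_ , τk≡i))      = subst P (sym τk≡i) Pi
  ... | inj₂ (inj₂ (_ , _ , τk≡k))  = subst P (sym τk≡k) Pk

  transpose-μ : ∀ {A : Set} (μ : Fin r → A) → μ i ≡ μ j → ∀ k → μ (transpose i j ⟨$⟩ʳ k) ≡ μ k
  transpose-μ μ μi≡μj k with transpose-cases k
  ... | inj₁ (k≡i , τk≡j)            = trans (cong μ τk≡j) (trans (sym μi≡μj) (cong μ (sym k≡i)))
  ... | inj₂ (inj₁ (k≡j , τk≡i))     = trans (cong μ τk≡i) (trans μi≡μj (cong μ (sym k≡j)))
  ... | inj₂ (inj₂ (_ , _ , τk≡k))   = cong μ τk≡k

  transpose-≢ : ∀ k → ¬ k ≡ i → ¬ transpose i j ⟨$⟩ʳ k ≡ j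
  transpose-≢ k k≢i τk≡j with transpose-cases k
  ... | inj₁ (k≡i , _)              = k≢i k≡i
  ... | inj₂ (inj₁ (k≡j , τk≡i))    = k≢i (trans k≡j (trans (sym τk≡j) τk≡i))
  ... | inj₂ (inj₂ (_ , k≢j , τk≡k)) = k≢j (trans (sym τk≡k) τk≡j)

  transpose-i : transpose i j ⟨$⟩ʳ i ≡ j
  transpose-i with transpose-cases i
  ... | inj₁ (_ , τi≡j)             = τi≡j
  ... | inj₂ (inj₁ (i≡j , τi≡i))    = trans τi≡i i≡j
  ... | inj₂ (inj₂ (i≢i , _ , _))   = ⊥-elim (i≢i refl)

  transpose-fixes : ∀ k → ¬ k ≡ i → ¬ k ≡ j → transpose i j ⟨$⟩ʳ k ≡ k
  transpose-fixes k k≢i k≢j with transpose-cases k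
  ... | inj₁ (k≡i , _)               = ⊥-elim (k≢i k≡i)
  ... | inj₂ (inj₁ (k≡j , _))        = ⊥-elim (k≢j k≡j)
  ... | inj₂ (inj₂ (_ , _ , τk≡k))   = τk≡k

module _ {r m : ℕ} (μ : Fin r → ℕ) where

  SortedBelow : ℕ → (Fin r → Vn m) → Set
  SortedBelow j F = ∀ k l → k Fin.< l → Fin.toℕ k ℕ.< j → μ k ≡ μ l → LexLt (F k) (F l)

  DistinctInClasses : (Fin r → Vn m) → Set
  DistinctInClasses F = ∀ k l → ¬ k ≡ l → μ k ≡ μ l → ¬ (∀ i → F k i ≡ F l i)

  LaterInClassOf : ℕ → Fin r → Fin r → Set
  LaterInClassOf j J l = j ℕ.≤ Fin.toℕ l × μ l ≡ μ J

  laterInClassOf? : ∀ j J → Decidable (LaterInClassOf j J)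
  laterInClassOf? j J l with j ℕ.≤? Fin.toℕ l | μ l ℕP.≟ μ J
  ... | yes j≤l | yes μl≡μJ = yes (j≤l , μl≡μJ)
  ... | no  j≰l | _         = no (λ later → j≰l (proj₁ later))
  ... | _       | no  μl≢μJ = no (λ later → μl≢μJ (proj₂ later))

  -- One step of selection sort: position j receives the least key among the positions ≥ j of its class.
  swapLeast-sorted : ∀ {j} {F : Fin r → Vn m} (J l : Fin r) → Fin.toℕ J ≡ j → LaterInClassOf j J l →
                     (∀ l′ → LaterInClassOf j J l′ → LexLe (F l) (F l′)) →
                     DistinctInClasses F → SortedBelow j F → SortedBelow (suc j) (λ k → F (transpose J l ⟨$⟩ʳ k))
  swapLeast-sorted {j} {F} J l toℕJ≡j (j≤l , μl≡μJ) least distinct sorted k l′ k<l′ k<1+j μk≡μl′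
    with ℕP.m≤n⇒m<n∨m≡n (ℕP.≤-pred k<1+j)
  ... | inj₁ k<j = subst (λ k″ → LexLt (F k″) (F (τ ⟨$⟩ʳ l′))) (sym τk≡k)
                         (sorted k (τ ⟨$⟩ʳ l′) k<τl′ k<j (trans μk≡μl′ (sym (transpose-μ J l μ (sym μl≡μJ) l′))))
    where
    τ : Permutation′ r
    τ = transpose J l
    τk≡k : τ ⟨$⟩ʳ k ≡ k
    τk≡k = transpose-fixes J l k (λ k≡J → ℕP.<-irrefl (trans (cong Fin.toℕ k≡J) toℕJ≡j) k<j)
                                 (λ k≡l → ℕP.<⇒≱ k<j (subst (λ x → j ℕ.≤ Fin.toℕ x) (sym k≡l) j≤l))
    k<τl′ : k Fin.< τ ⟨$⟩ʳ l′
    k<τl′ = transpose-preserves J l (k Fin.<_) (subst (Fin.toℕ k ℕ.<_) (sym toℕJ≡j) k<j)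
                                    (ℕP.<-≤-trans k<j j≤l) l′ k<l′
  ... | inj₂ k≡j = subst (λ k″ → LexLt (F k″) (F (τ ⟨$⟩ʳ l′))) (sym τk≡l)
                         (lexLe-≢⇒lex (least (τ ⟨$⟩ʳ l′) τl′-later)
                                      (distinct l (τ ⟨$⟩ʳ l′) (λ l≡τl′ → transpose-≢ J l l′ l′≢J (sym l≡τl′))
                                                (trans μl≡μJ (sym (proj₂ τl′-later)))))
    where
    τ : Permutation′ r
    τ = transpose J l
    k≡J : k ≡ J
    k≡J = FinP.toℕ-injective (trans k≡j (sym toℕJ≡j))
    τk≡l : τ ⟨$⟩ʳ k ≡ l
    τk≡l = trans (cong (τ ⟨$⟩ʳ_) k≡J) (transpose-i J l)
    l′≢J : ¬ l′ ≡ J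
    l′≢J l′≡J = ℕP.<-irrefl (cong Fin.toℕ (trans k≡J (sym l′≡J))) k<l′
    τl′-later : LaterInClassOf j J (τ ⟨$⟩ʳ l′)
    τl′-later = transpose-preserves J l (LaterInClassOf j J) (ℕP.≤-reflexive (sym toℕJ≡j) , refl) (j≤l , μl≡μJ) l′
                  (ℕP.<⇒≤ (subst (ℕ._< Fin.toℕ l′) (trans (cong Fin.toℕ k≡J) toℕJ≡j) k<l′) ,
                   trans (sym μk≡μl′) (cong μ k≡J))

  selectionStep : ∀ j (j<r : j ℕ.< r) (F : Fin r → Vn m) → DistinctInClasses F → SortedBelow j F →
                  ∃[ τ ] ((∀ k → μ (τ ⟨$⟩ʳ k) ≡ μ k) × SortedBelow (suc j) (λ k → F (τ ⟨$⟩ʳ k)))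
  selectionStep j j<r F distinct sorted =
    swapIn (lexMinimum (laterInClassOf? j J) F (J , ℕP.≤-reflexive (sym toℕJ≡j) , refl))
    where
    J : Fin r
    J = Fin.fromℕ< j<r
    toℕJ≡j : Fin.toℕ J ≡ j
    toℕJ≡j = FinP.toℕ-fromℕ< j<r
    swapIn : ∃[ l ] (LaterInClassOf j J l × (∀ l′ → LaterInClassOf j J l′ → LexLe (F l) (F l′))) →
             ∃[ τ ] ((∀ k → μ (τ ⟨$⟩ʳ k) ≡ μ k) × SortedBelow (suc j) (λ k → F (τ ⟨$⟩ʳ k)))
    swapIn (l , later , least) =
      transpose J l , transpose-μ J l μ (sym (proj₂ later)) , swapLeast-sorted J l toℕJ≡j later least distinct sorted

  distinctInClasses-permute : ∀ {F : Fin r → Vn m} (π : Permutation′ r) → (∀ k → μ (π ⟨$⟩ʳ k) ≡ μ k) →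
                              DistinctInClasses F → DistinctInClasses (λ k → F (π ⟨$⟩ʳ k))
  distinctInClasses-permute π μπ≡μ distinct k l k≢l μk≡μl =
    distinct (π ⟨$⟩ʳ k) (π ⟨$⟩ʳ l)
             (λ πk≡πl → k≢l (trans (sym (inverseˡ π)) (trans (cong (π ⟨$⟩ˡ_) πk≡πl) (inverseˡ π))))
             (trans (μπ≡μ k) (trans μk≡μl (sym (μπ≡μ l))))

  sortWithinClasses : ∀ (F : Fin r → Vn m) → DistinctInClasses F →
                      ∃[ π ] ((∀ k → μ (π ⟨$⟩ʳ k) ≡ μ k) × SortedBelow r (λ k → F (π ⟨$⟩ʳ k)))
  sortWithinClasses F distinct = sortBelow r ℕP.≤-refl
    where
    Sorting : ℕ → Set
    Sorting j = ∃[ π ] ((∀ k → μ (π ⟨$⟩ʳ k) ≡ μ k) × SortedBelow j (λ k → F (π ⟨$⟩ʳ k)))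
    extend : ∀ j (j<r : j ℕ.< r) → Sorting j → Sorting (suc j)
    extend j j<r (π , μπ≡μ , sorted) = compose (selectionStep j j<r _ (distinctInClasses-permute π μπ≡μ distinct) sorted)
      where
      compose : ∃[ τ ] ((∀ k → μ (τ ⟨$⟩ʳ k) ≡ μ k) × SortedBelow (suc j) (λ k → F (π ⟨$⟩ʳ (τ ⟨$⟩ʳ k)))) →
                Sorting (suc j)
      compose (τ , μτ≡μ , sorted′) = τ ∘ₚ π , (λ k → trans (μπ≡μ (τ ⟨$⟩ʳ k)) (μτ≡μ k)) , sorted′
    sortBelow : ∀ j → j ℕ.≤ r → Sorting j
    sortBelow zero    _   = Perm.id , (λ k → refl) , λ k l _ ()
    sortBelow (suc j) j<r = extend j j<r (sortBelow j (ℕP.<⇒≤ j<r))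

≡0-mod⇒≤1 : ∀ {μ} → + 1 ≡ + 0 mod μ → μ ℕ.≤ 1
≡0-mod⇒≤1 {μ} 1≡0 = ℕD.∣⇒≤ (S.∣⇒∣ᵤ (≡0⇒divisible (mod-trans 1≡0 mod-refl)))

rep-injective′ : ∀ {μ x y} → 1 ℕ.≤ μ → rep μ x ≡ rep μ y → x ≡ y mod μ
rep-injective′ {suc m} _ = rep-injective m

generates⇒distinctRows : ∀ {n r} {μ : Fin r → ℕ} {Q : Fin (suc n) → G r} → (∀ k → 2 ℕ.≤ μ k) →
                         Generates μ Q → DistinctInClasses μ (λ k → reps (μ k) (torsionRow Q k))
generates⇒distinctRows {μ = μ} {Q} μ≥2 gen k l k≢l μk≡μl same with gen zero (+ 0 , e k)
... | x , _ , Qx≈eₖ = ℕP.<⇒≱ (μ≥2 k) (≡0-mod⇒≤1 1≡0)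
  where
  open ModReasoning (μ k)
  column-≡ : ∀ i → proj₂ (Q i) k ≡ proj₂ (Q i) l mod μ k
  column-≡ i = rep-injective′ (ℕP.<⇒≤ (μ≥2 k)) (trans (same i) (cong (λ m → rep m (proj₂ (Q i) l)) (sym μk≡μl)))
  1≡0 : + 1 ≡ + 0 mod μ k
  1≡0 = begin
    + 1                                   ≡⟨ e-diag k ⟨
    e k k                                 ≈⟨ torsion-≡ Qx≈eₖ k ⟨
    sumᶠ (λ i → x i * proj₂ (Q i) k)       ≈⟨ sum-mod (λ i → mod-*ˡ (x i) (column-≡ i)) ⟩
    sumᶠ (λ i → x i * proj₂ (Q i) l)       ≈⟨ subst (λ m → _ ≡ _ mod m) (sym μk≡μl) (torsion-≡ Qx≈eₖ l) ⟩
    e k l                                 ≡⟨ e-offdiag k l k≢l ⟩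
    + 0                                   ∎

-- The normal form

record NormalForm {n r} (μ : Fin r → ℕ) (P : Mat n (suc n)) (Q : Fin (suc n) → G r) : Set where
  field
    presentation : GorensteinPresentation μ P Q
    positive     : ∀ i → + 1 ℤ.≤ weightRow Q i
    minimal      : ∀ k → MinimalTorsion (weightRow Q) (μ k) (torsionRow Q k)
    sorted       : ∀ k l → k < l → μ k ≡ μ l →
                   LexLt (reps (μ k) (torsionRow Q k)) (reps (μ l) (torsionRow Q l))

module _ {n r} {μ : Fin r → ℕ} {P : Mat n (suc n)} (μ≥2 : ∀ k → 2 ℕ.≤ μ k) where

  shearRows : ∀ {Q} → GorensteinPresentation μ P Q → (∀ i → + 1 ℤ.≤ weightRow Q i) →
              ∃[ Q′ ] (GorensteinPresentation μ P Q′ × (∀ i → + 1 ℤ.≤ weightRow Q′ i) ×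
                       (∀ k → MinimalTorsion (weightRow Q′) (μ k) (torsionRow Q′ k)))
  shearRows {Q} pres w≥1 = (λ i → Aut.to φ (Q i)) , presentation-aut φ pres , w≥1 , λ k → MinimalShear.minimal (shear k)
    where
    w₀≢0 : ¬ weightRow Q zero ≡ + 0
    w₀≢0 w₀≡0 with subst (+ 1 ℤ.≤_) w₀≡0 (w≥1 zero)
    ... | ℤ.+≤+ ()
    shear : ∀ k → MinimalShear (μ k) (weightRow Q) (torsionRow Q k)
    shear k = minimalShear (μ k) (μ≥2 k) (weightRow Q) (torsionRow Q k) w₀≢0
    φ : Aut μ
    φ = shearAut (MinimalShear.a ∘ shear) (MinimalShear.b ∘ shear) (MinimalShear.c ∘ shear) (MinimalShear.ab≡1 ∘ shear)

  permuteRows : ∀ {Q} → GorensteinPresentation μ P Q → (∀ i → + 1 ℤ.≤ weightRow Q i) →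
                (∀ k → MinimalTorsion (weightRow Q) (μ k) (torsionRow Q k)) →
                ∃[ π ] ((∀ k → μ (π ⟨$⟩ʳ k) ≡ μ k) ×
                        SortedBelow μ r (λ k → reps (μ (π ⟨$⟩ʳ k)) (torsionRow Q (π ⟨$⟩ʳ k)))) →
                ∃[ Q′ ] NormalForm μ P Q′
  permuteRows {Q} pres w≥1 minimal (π , μπ≡μ , sorted) = (λ i → Aut.to (permuteAut π μπ≡μ) (Q i)) , record
    { presentation = presentation-aut (permuteAut π μπ≡μ) pres
    ; positive = w≥1
    ; minimal = λ k → subst (λ m → MinimalTorsion (weightRow Q) m (row (π ⟨$⟩ʳ k)))
                            (μπ≡μ k) (minimal (π ⟨$⟩ʳ k))
    ; sorted = λ k l k<l μk≡μl → subst₂ (λ m m′ → LexLt (reps m (row (π ⟨$⟩ʳ k))) (reps m′ (row (π ⟨$⟩ʳ l))))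
                                        (μπ≡μ k) (μπ≡μ l) (sorted k l k<l (FinP.toℕ<n k) μk≡μl) }
    where
    row : Fin r → Vz (suc n)
    row = torsionRow Q

  sortRows : ∀ {Q} → GorensteinPresentation μ P Q → (∀ i → + 1 ℤ.≤ weightRow Q i) →
             (∀ k → MinimalTorsion (weightRow Q) (μ k) (torsionRow Q k)) → ∃[ Q′ ] NormalForm μ P Q′
  sortRows {Q} pres w≥1 minimal =
    permuteRows pres w≥1 minimal
      (sortWithinClasses μ (λ k → reps (μ k) (torsionRow Q k)) (generates⇒distinctRows {Q = Q} μ≥2 (generates pres)))

fwps⇒normalForm : ∀ {n} {P : Mat (suc n) (suc (suc n))} → IsFWPS P → Gorenstein P →
                  ∀ {r} {μ : Fin r → ℕ} → (∀ k → 2 ℕ.≤ μ k) → ClassGroupIso P μ → ∃[ Q ] NormalForm μ P Q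
fwps⇒normalForm {P = P} fwps gor {μ = μ} μ≥2 cl =
  shear (fwps⇒positivePresentation fwps gor (λ k → ℕP.<⇒≤ (μ≥2 k)) cl)
  where
  sort : ∃[ Q ] (GorensteinPresentation μ P Q × (∀ i → + 1 ℤ.≤ weightRow Q i) ×
                 (∀ k → MinimalTorsion (weightRow Q) (μ k) (torsionRow Q k))) → ∃[ Q ] NormalForm μ P Q
  sort (Q , pres , w≥1 , minimal) = sortRows μ≥2 pres w≥1 minimal
  shear : ∃[ Q ] (GorensteinPresentation μ P Q × (∀ i → + 1 ℤ.≤ weightRow Q i)) → ∃[ Q ] NormalForm μ P Q
  shear (Q , pres , w≥1) = sort (shearRows μ≥2 pres w≥1)

module Rows {n r} {μ : Fin r → ℕ} {P : Mat (suc n) (suc (suc n))} {Q : Fin (suc (suc n)) → G r}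
            (pres : GorensteinPresentation μ P Q) (w≥1 : ∀ i → + 1 ℤ.≤ weightRow Q i) where

  w : Vz (suc (suc n))
  w = weightRow Q

  degreeMatrix : DegreeMatrix μ Q
  degreeMatrix = w≥1 , λ i g → let (x , xᵢ≡0 , Qx≈g) = generates pres i g in x , xᵢ≡0 , ≈⇒Eq μ Qx≈g

  weightVector : WeightVector w
  weightVector = w≥1 , λ i g → let (x , xᵢ≡0 , Qx≈g) = generates pres i (proj₁ g , λ _ → + 0)
                              in x , xᵢ≡0 , weight-≡ Qx≈g , λ ()

  torsionVector : ∀ k → TorsionVector w (μ k) (torsionRow Q k)
  torsionVector k = w≥1 , λ i g →
    let (x , xᵢ≡0 , Qx≈g) = generates pres i (proj₁ g , λ _ → proj₂ g zero)
    in x , xᵢ≡0 , weight-≡ Qx≈g , λ { zero → S.∣⇒∣ᵤ (divides-difference (torsion-≡ Qx≈g k)) }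

  w-nonzero : ∃[ x ] ¬ dot w x ≡ + 0
  w-nonzero = let (x , _ , Qx≈e₁) = generates pres zero (+ 1 , λ _ → + 0)
              in x , λ wx≡0 → 1≢0 (trans (sym (weight-≡ Qx≈e₁)) (trans (dot-comm x w) wx≡0))
    where
    1≢0 : ¬ + 1 ≡ + 0
    1≢0 ()

  gorensteinWeightVector : GorensteinWeightVector w
  gorensteinWeightVector = weightVector , kernel (weightVector-kernelBasis w w-nonzero)
    where
    kernel : ∃[ P′ ] KernelBasis noTorsion (asG0 w) P′ → GorensteinDeg noTorsion (asG0 w)
    kernel (P′ , basis) = P′ , basis , anticanonical⇒gorenstein {μ = noTorsion} {Q = asG0 w} {P′ = P′} basis
      (λ i → let (y , Σ≈yQᵢ) = anticanonical pres i in y , mk≈ (weight-≡ Σ≈yQᵢ) (λ ()))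

  gorensteinTorsionVector : ∀ k → 1 ℕ.≤ μ k → GorensteinTorsionVector w (μ k) (torsionRow Q k)
  gorensteinTorsionVector k 1≤μ = torsionVector k , kernel (torsionVector-kernelBasis w η (μ k) 1≤μ w-nonzero)
    where
    η : Vz (suc (suc n))
    η = torsionRow Q k
    kernel : ∃[ P′ ] KernelBasis (oneTorsion (μ k)) (asG1 w η) P′ → GorensteinDeg (oneTorsion (μ k)) (asG1 w η)
    kernel (P′ , basis) =
      P′ , basis , anticanonical⇒gorenstein {μ = oneTorsion (μ k)} {Q = asG1 w η} {P′ = P′} basis
        (λ i → let (y , Σ≈yQᵢ) = anticanonical pres i in y , mk≈ (weight-≡ Σ≈yQᵢ) (λ { zero → torsion-≡ Σ≈yQᵢ k }))

FWPSIso-refl : ∀ {n} (P : Mat n (suc n)) → FWPSIso P P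
FWPSIso-refl P = identity , (identity , inverse , inverse) , Perm.id , λ i k → sum-e k (col P i)
  where
  identity : Mat _ _
  identity = e
  inverse : ∀ v k → matVec identity (matVec identity v) k ≡ v k
  inverse v k = trans (sum-e k _) (sum-e k v)

normalForm⇒minimalGorensteinDegreeMatrix :
    ∀ {n r} {μ : Fin r → ℕ} {P : Mat (suc n) (suc (suc n))} {Q : Fin (suc (suc n)) → G r} →
    (∀ k → 1 ℕ.≤ μ k) → NormalForm μ P Q →
    DegreeMatrix μ Q
      × (∃[ P′ ] (KernelBasis μ Q P′ × FWPSIso P P′))
      × GorensteinWeightVector (weightRow Q)
      × (∀ k → MinimalGorensteinTorsionVector (weightRow Q) (μ k) (torsionRow Q k))
      × (∀ k l → k < l → μ k ≡ μ l →
           LexLt (reps (μ k) (torsionRow Q k)) (reps (μ l) (torsionRow Q l)))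
normalForm⇒minimalGorensteinDegreeMatrix {P = P} μ≥1 normal =
    degreeMatrix , (P , kernelBasis presentation , FWPSIso-refl P) , gorensteinWeightVector
  , (λ k → gorensteinTorsionVector k (μ≥1 k) , minimal k) , sorted
  where
  open NormalForm normal
  open Rows presentation positive

proposition4p5 : (n : ℕ) → 1 ≤ n → (P : Mat n (suc n)) → IsFWPS P → Gorenstein P →
    (r : ℕ) (μ : Fin r → ℕ) → InvariantFactorForm μ → ClassGroupIso P μ →
    ∃[ Q ] (DegreeMatrix μ Q
      × (∃[ P' ] (KernelBasis μ Q P' × FWPSIso P P'))
      × GorensteinWeightVector (weightRow Q)
      × (∀ k → MinimalGorensteinTorsionVector (weightRow Q) (μ k) (torsionRow Q k))
      × (∀ k l → k < l → μ k ≡ μ l →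
           LexLt (reps (μ k) (torsionRow Q k)) (reps (μ l) (torsionRow Q l))))
proposition4p5 zero    () P fwps gor r μ invariant cl
proposition4p5 (suc n) _  P fwps gor r μ (μ≥2 , _) cl =
  let (Q , normal) = fwps⇒normalForm fwps gor μ≥2 cl
  in Q , normalForm⇒minimalGorensteinDegreeMatrix (λ k → ℕP.<⇒≤ (μ≥2 k)) normal
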